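{- Let $\mathcal O$ be a $\mathcal{RIQ}$-ontology. (i) Every sequent of the form $\Gamma\vdash\Delta,x:\top$ is provable in $\mathsf S(\mathcal O)$. (ii) The following rules are height-preserving admissible in $\mathsf S(\mathcal O)$: $(x/y)$: from $\Gamma\vdash\Delta$ infer $\Gamma(x/y)\vdash\Delta(x/y)$, where $x$ is fresh; $(w_\doteq)$: from $\Gamma\vdash\Delta$ infer $\Gamma,x\doteq y\vdash\Delta$, where $x,y\in\mathrm{Lab}(\Gamma,\Delta)$; $(w_{\not\doteq})$: from $\Gamma\vdash\Delta$ infer $\Gamma,x\not\doteq y\vdash\Delta$, where $x,y\in\mathrm{Lab}(\Gamma,\Delta)$; $(w)$: from $\Gamma\vdash\Delta$ infer $\Gamma\vdash\Delta,x:C$, where $x\in\mathrm{Lab}(\Gamma,\Delta)$; $(c)$: from $\Gamma\vdash\Delta,x:C,x:C$ infer $\Gamma\vdash\Delta,x:C$; $(s_{\not\doteq})$: from $\Gamma,x\not\doteq y,y\not\doteq x\vdash\Delta$ infer $\Gamma,x\not\doteq y\vdash\Delta$.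
   Context: Language. Fix countable pairwise disjoint sets $\mathsf{N_C}$ (concept names) and $\mathsf{N_R}$ (role names). A role is $r$ or $r^-$ with $r\in\mathsf{N_R}$; $\mathrm{Inv}(r)=r^-$, $\mathrm{Inv}(r^-)=r$; $\mathbf{R}$ is the set of roles. An RIA is $r_1\circ\cdots\circ r_n\sqsubseteq s$ with $r_i,s\in\mathbf R$; an RBox is a finite set of RIAs. It is regular iff for some strict partial order $\prec$ on $\mathsf{N_R}$ every RIA $w\sqsubseteq r$ in it has $r\in\mathsf{N_R}$ and $w$ equal to $r\circ r$, $r^-$, $s_1\circ\cdots\circ s_n$, $r\circ s_1\circ\cdots\circ s_n$, or $s_1\circ\cdots\circ s_n\circ r$ with all $s_i\prec r$. A role name $r$ is simple w.r.t. RBox $\mathcal R$ iff no RIA $w\sqsubseteq r$ is in $\mathcal R$, or for each $s\sqsubseteq r\in\mathcal R$, $s$ is a simple role name or the inverse of one; $r^-$ is simple iff $r$ is. Concepts: $C::=A\mid\neg A\mid C\sqcup C\mid C\sqcap C\mid\exists r.C\mid\forall r.C\mid{\leqslant}n\,s.C\mid{\geqslant}n\,s.C$ ($A\in\mathsf{N_C}$, $r\in\mathbf R$, $s$ simple, $n\in\mathbb N$). $\top:=A_0\sqcup\neg A_0$, $\bot:=A_0\sqcap\neg A_0$ for fixed $A_0$; literals are $A,\neg A$. Negation $\dot\neg$: $\dot\neg A=\neg A$, $\dot\neg\neg A=A$, De Morgan on $\sqcup,\sqcap$, $\exists/\forall$ dual, $\dot\neg({\leqslant}n\,s.C)={\geqslant}(n{+}1)\,s.C$,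 $\dot\neg({\geqslant}0\,s.C)=\bot$, $\dot\neg({\geqslant}n\,s.C)={\leqslant}(n{ - }1)\,s.C$ ($n>0$). A TBox is a finite set of GCIs, each $\top\sqsubseteq C$; a $\mathcal{RIQ}$-ontology is $\mathcal R\cup\mathcal T$, $\mathcal R$ regular RBox, $\mathcal T$ TBox. $\mathbf R$-system: for each RIA $r_1\circ\cdots\circ r_n\sqsubseteq s\in\mathcal O$ there are productions $s\to r_1\cdots r_n$ and $\mathrm{Inv}(s)\to\mathrm{Inv}(r_n)\cdots\mathrm{Inv}(r_1)$; a rewrite replaces one occurrence of a role $t$ in a string by $T$ for a production $t\to T$; $L_{\mathcal O}(r)$ is the set of strings reachable from the string $r$ by zero or more rewrites. Sequents: $\mathrm{Lab}$ is a countably infinite set of labels. Structural atoms: $r(x,y)$, $x\doteq y$, $x\not\doteq y$; labeled concepts $x:C$. $\Gamma$ forms a tree iff the directed graph on $\mathrm{Lab}(\Gamma)$ with an edge $(x,y)$ per $r(x,y)\in\Gamma$ is a directed tree. A sequent $\Gamma\vdash\Delta$: $\Gamma$ a set of structural atoms forming a tree, $\Delta$ a multiset of labeled concepts, $\mathrm{Lab}(\Delta)\subseteq\mathrm{Lab}(\Gamma)$ if $\Gamma\ne\emptyset$, exactly one label in $\Delta$ if $\Gamma=\emptyset$. $S(x/y)$ denotes the result of replacing every occurrence of label $y$ by $x$. If the TBox is $\{\top\sqsubseteq C_1,\dots,\top\sqsubseteq C_n\}$, $y:\mathrm{GCI}(\mathcal O)$ denotes $y:\dot\neg C_1,\dots,y:\dot\neg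 C_n$. $\neq(y_0,\dots,y_n)=\{y_i\not\doteq y_j\mid i<j\}$. $x=^*_\Gamma y$ iff $x,y$ are connected by a (possibly trivial) chain of labels of $\Gamma$ with consecutive ones related by an equality atom of $\Gamma$ in either orientation; $[x]_\Gamma$ its class. Propagation graph of $\Gamma$: vertices $[x]_\Gamma$, edges $([x]_\Gamma,r,[y]_\Gamma)$ and $([y]_\Gamma,\mathrm{Inv}(r),[x]_\Gamma)$ whenever $r(z,w)\in\Gamma$, $z\in[x]_\Gamma$, $w\in[y]_\Gamma$. $[x]_\Gamma\xrightarrow{\varepsilon}[y]_\Gamma$ iff equal; $[x]_\Gamma\xrightarrow{rS}[y]_\Gamma$ iff some edge $([x]_\Gamma,r,[z]_\Gamma)$ with $[z]_\Gamma\xrightarrow{S}[y]_\Gamma$; $[x]_\Gamma\xrightarrow{L}[y]_\Gamma$ iff this holds for some $S\in L$. Calculus $\mathsf S(\mathcal O)$ (premises / conclusion; fresh = not occurring in the conclusion): (id) none / $\Gamma\vdash x:A,x:\neg A,\Delta$. (id$_\doteq$) none / $\Gamma,x\not\doteq y\vdash\Delta$ if $x=^*y$ in the antecedent. ($s_\doteq$) $\Gamma\vdash x:L,y:L,\Delta$ / $\Gamma\vdash x:L,\Delta$ ($L$ literal, $x=^*_\Gamma y$). ($\sqcup$) $\Gamma\vdash x:C,x:D,\Delta$ / $\Gamma\vdash x:C\sqcup D,\Delta$. ($\sqcap$) $\Gamma\vdash x:C,\Delta$ and $\Gamma\vdash x:D,\Delta$ / $\Gamma\vdash x:C\sqcap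 D,\Delta$. ($\exists r$) $\Gamma\vdash x:\exists r.C,y:C,\Delta$ / $\Gamma\vdash x:\exists r.C,\Delta$ if $[x]_\Gamma\xrightarrow{L}[y]_\Gamma$, $L=L_{\mathcal O}(r)$. ($\forall r$) $\Gamma,r(x,y)\vdash y:C,y:\mathrm{GCI}(\mathcal O),\Delta$ / $\Gamma\vdash x:\forall r.C,\Delta$, $y$ fresh. (${\leqslant}n\,r$) $\Gamma,\neq(y_0,\dots,y_n),r(x,y_0),\dots,r(x,y_n)\vdash y_0:\dot\neg C,y_0:\mathrm{GCI}(\mathcal O),\dots,y_n:\dot\neg C,y_n:\mathrm{GCI}(\mathcal O),\Delta$ / $\Gamma\vdash x:{\leqslant}n\,r.C,\Delta$, $y_i$ fresh. (${\geqslant}n\,r$) $\Gamma\vdash y_i:C,x:{\geqslant}n\,r.C,\Delta$ ($1\le i\le n$) and $\Gamma,y_i\doteq y_j\vdash x:{\geqslant}n\,r.C,\Delta$ ($1\le i<j\le n$) / $\Gamma\vdash x:{\geqslant}n\,r.C,\Delta$ if $[x]_\Gamma\xrightarrow{L}[y_i]_\Gamma$, $L=L_{\mathcal O}(r)$, for all $i$. A proof is a finite tree of rule instances with its conclusion at the root; its height is the number of sequents on a maximal branch from the conclusion to an initial rule instance. A rule (premises $S_1,\dots,S_n$, conclusion $S$) is height-preserving admissible iff whenever each $S_i$ has a proof of height $h_i$, $S$ has a proof of height at most $\max_i h_i$. For the rule $(x/y)$, "$x$ is fresh" means $x$ does not occur in the premise. -}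

module Defs where

open import Level using (Level) renaming (suc to lsuc; zero to lzero)
open import Data.Nat using (ℕ; zero; suc; _<_; _≥_)
open import Data.Fin using (Fin) renaming (_<_ to _<ᶠ_)
open import Data.Vec using (Vec; lookup)
open import Data.List using (List; []; _∷_; _++_; map; reverse; length; concat)
open import Data.List.NonEmpty using (List⁺; toList)
open import Data.List.Membership.Propositional using (_∈_; _∉_)
open import Data.List.Relation.Unary.All using (All)
open import Data.List.Relation.Unary.Any using (Any)
open import Data.List.Relation.Unary.Unique.Propositional using (Unique)
open import Data.List.Relation.Binary.Permutation.Propositional using (_↭_)
open import Data.Product using (Σ; ∃; _×_; _,_; proj₁; proj₂)
open import Data.Sum using (_⊎_)
open import Relation.Nullary using (¬_)
open import Relation.Binary.PropositionalEquality using (_≡_; _≢_)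
open import Relation.Binary.Structures using (IsStrictPartialOrder)
open import Relation.Binary.Construct.Closure.ReflexiveTransitive using (Star)

CName : Set
CName = ℕ

RName : Set
RName = ℕ

Label : Set
Label = ℕ

data Role : Set where
  rn  : RName → Role
  inv : RName → Role

Inv : Role → Role
Inv (rn r)  = inv r
Inv (inv r) = rn r

name : Role → RName
name (rn r)  = r
name (inv r) = r

record RIA : Set where
  constructor _⊑_
  field
    lhs : List⁺ Role
    rhs : Role
open RIA public

RBox : Set
RBox = List RIA

data RegForm (_≺_ : RName → RName → Set) (r : RName) : List Role → Set where
  f-trans : RegForm _≺_ r (rn r ∷ rn r ∷ [])
  f-inv   : RegForm _≺_ r (inv r ∷ [])
  f-plain : (ss : List⁺ Role) → All (λ s → name s ≺ r) (toList ss) →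
            RegForm _≺_ r (toList ss)
  f-left  : (ss : List⁺ Role) → All (λ s → name s ≺ r) (toList ss) →
            RegForm _≺_ r (rn r ∷ toList ss)
  f-right : (ss : List⁺ Role) → All (λ s → name s ≺ r) (toList ss) →
            RegForm _≺_ r (toList ss ++ rn r ∷ [])

RegularRIA : (RName → RName → Set) → RIA → Set
RegularRIA _≺_ ia = Σ RName λ r → (rhs ia ≡ rn r) × RegForm _≺_ r (toList (lhs ia))

Regular : RBox → Set₁
Regular R = Σ (RName → RName → Set) λ _≺_ →
  IsStrictPartialOrder _≡_ _≺_ × All (RegularRIA _≺_) R

-- Simplicity (standard reading): r is non-simple iff some RIA w ⊑ r has
-- |w| ≥ 2, or some RIA s ⊑ r has s non-simple (inductively); a role
-- name is simple iff it is not non-simple; r⁻ is simple iff r is.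
data NonSimple (R : RBox) : RName → Set where
  ns-comp : ∀ {ia r} → ia ∈ R → rhs ia ≡ rn r →
            length (toList (lhs ia)) ≥ 2 → NonSimple R r
  ns-sub  : ∀ {ia r s} → ia ∈ R → rhs ia ≡ rn r →
            toList (lhs ia) ≡ s ∷ [] → NonSimple R (name s) → NonSimple R r

Simple : RBox → Role → Set
Simple R s = ¬ NonSimple R (name s)

-- Concepts (negation normal form)

data Concept : Set where
  at     : CName → Concept
  nat    : CName → Concept
  _⊔_    : Concept → Concept → Concept
  _⊓_    : Concept → Concept → Concept
  ex     : Role → Concept → Concept
  all    : Role → Concept → Concept
  atmost : ℕ → Role → Concept → Concept
  atleast : ℕ → Role → Concept → Concept

data WFC (R : RBox) : Concept → Set where
  wf-at   : ∀ {A} → WFC R (at A)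
  wf-nat  : ∀ {A} → WFC R (nat A)
  wf-⊔    : ∀ {C D} → WFC R C → WFC R D → WFC R (C ⊔ D)
  wf-⊓    : ∀ {C D} → WFC R C → WFC R D → WFC R (C ⊓ D)
  wf-ex   : ∀ {r C} → WFC R C → WFC R (ex r C)
  wf-all  : ∀ {r C} → WFC R C → WFC R (all r C)
  wf-atmost  : ∀ {n s C} → Simple R s → WFC R C → WFC R (atmost n s C)
  wf-atleast : ∀ {n s C} → Simple R s → WFC R C → WFC R (atleast n s C)

A₀ : CName
A₀ = 0

⊤c : Concept
⊤c = at A₀ ⊔ nat A₀

⊥c : Concept
⊥c = at A₀ ⊓ nat A₀

data Literal : Concept → Set where
  lit-pos : ∀ {A} → Literal (at A)
  lit-neg : ∀ {A} → Literal (nat A)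

¬̇ : Concept → Concept
¬̇ (at A) = nat A
¬̇ (nat A) = at A
¬̇ (C ⊔ D) = ¬̇ C ⊓ ¬̇ D
¬̇ (C ⊓ D) = ¬̇ C ⊔ ¬̇ D
¬̇ (ex r C) = all r (¬̇ C)
¬̇ (all r C) = ex r (¬̇ C)
¬̇ (atmost n s C) = atleast (suc n) s C
¬̇ (atleast zero s C) = ⊥c
¬̇ (atleast (suc n) s C) = atmost n s C

-- Ontologies: TBox = finite set of GCIs ⊤ ⊑ C (we store the C's)

record Ontology : Set where
  field
    rbox : RBox
    tbox : List Concept
open Ontology public

RIQ : Ontology → Set₁
RIQ O = Regular (rbox O) × All (WFC (rbox O)) (tbox O) × Unique (tbox O)

data Prod (O : Ontology) : Role → List Role → Set where
  prod     : ∀ {ia} → ia ∈ rbox O → Prod O (rhs ia) (toList (lhs ia))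
  prod-inv : ∀ {ia} → ia ∈ rbox O →
             Prod O (Inv (rhs ia)) (reverse (map Inv (toList (lhs ia))))

data Rewrite (O : Ontology) : List Role → List Role → Set where
  rw : ∀ {t T} (u v : List Role) → Prod O t T →
       Rewrite O (u ++ t ∷ v) (u ++ T ++ v)

L : Ontology → Role → List Role → Set
L O r S = Star (Rewrite O) (r ∷ []) S

data SAtom : Set where
  rel : Role → Label → Label → SAtom
  eq  : Label → Label → SAtom
  neq : Label → Label → SAtom

LConcept : Set
LConcept = Label × Concept

record Seq : Set where
  constructor _⊢_
  field
    ante : List SAtom
    succ : List LConcept
open Seq public

data OccA (x : Label) : SAtom → Set where
  occ-rel₁ : ∀ {r y} → OccA x (rel r x y)
  occ-rel₂ : ∀ {r y} → OccA x (rel r y x)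
  occ-eq₁  : ∀ {y} → OccA x (eq x y)
  occ-eq₂  : ∀ {y} → OccA x (eq y x)
  occ-neq₁ : ∀ {y} → OccA x (neq x y)
  occ-neq₂ : ∀ {y} → OccA x (neq y x)

_∈LabA_ : Label → List SAtom → Set
x ∈LabA Γ = Any (OccA x) Γ

_∈LabC_ : Label → List LConcept → Set
x ∈LabC Δ = Any (λ yC → proj₁ yC ≡ x) Δ

_∈Lab_ : Label → Seq → Set
x ∈Lab S = (x ∈LabA ante S) ⊎ (x ∈LabC succ S)

Fresh : Label → Seq → Set
Fresh x S = ¬ (x ∈Lab S)

data Reach (Γ : List SAtom) : Label → Label → Set where
  here : ∀ {x} → Reach Γ x x
  step : ∀ {r x y z} → rel r x y ∈ Γ → Reach Γ y z → Reach Γ x z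

IsTreeRootedAt : List SAtom → Label → Set
IsTreeRootedAt Γ ρ =
  ρ ∈LabA Γ ×
  (∀ r z → rel r z ρ ∉ Γ) ×
  (∀ v → v ∈LabA Γ → v ≢ ρ →
     Σ Role λ r → Σ Label λ z → rel r z v ∈ Γ ×
       (∀ r' z' → rel r' z' v ∈ Γ → (r' ≡ r) × (z' ≡ z))) ×
  (∀ v → v ∈LabA Γ → Reach Γ ρ v)

FormsTree : List SAtom → Set
FormsTree Γ = (Γ ≡ []) ⊎ (Σ Label λ ρ → IsTreeRootedAt Γ ρ)

IsSeq : Ontology → Seq → Set
IsSeq O (Γ ⊢ Δ) =
  FormsTree Γ ×
  All (λ xC → WFC (rbox O) (proj₂ xC)) Δ ×
  ( ((Γ ≡ []) × (Σ Label λ x → x ∈LabC Δ × (∀ y → y ∈LabC Δ → y ≡ x)))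
  ⊎ ((Γ ≢ []) × (∀ y → y ∈LabC Δ → y ∈LabA Γ)) )

data EqStep (Γ : List SAtom) : Label → Label → Set where
  fwd : ∀ {x y} → eq x y ∈ Γ → EqStep Γ x y
  bwd : ∀ {x y} → eq y x ∈ Γ → EqStep Γ x y

_≐*[_]_ : Label → List SAtom → Label → Set
x ≐*[ Γ ] y = Star (EqStep Γ) x y

data PPath (Γ : List SAtom) : Label → List Role → Label → Set where
  p-nil  : ∀ {x y} → x ≐*[ Γ ] y → PPath Γ x [] y
  p-fwd  : ∀ {x z w y r S} → x ≐*[ Γ ] z → rel r z w ∈ Γ →
           PPath Γ w S y → PPath Γ x (r ∷ S) y
  p-bwd  : ∀ {x z w y r S} → x ≐*[ Γ ] z → rel r w z ∈ Γ →
           PPath Γ w S y → PPath Γ x (Inv r ∷ S) y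

PropL : Ontology → List SAtom → Label → Role → Label → Set
PropL O Γ x r y = Σ (List Role) λ S → L O r S × PPath Γ x S y

GCI : Ontology → Label → List LConcept
GCI O y = map (λ C → (y , ¬̇ C)) (tbox O)

neqs : List Label → List SAtom
neqs [] = []
neqs (y ∷ ys) = map (neq y) ys ++ neqs ys

-- Der O h S : S has a proof of height ≤ h
-- (height = number of sequents on a maximal branch; an initial rule
-- instance has height 1).  Δ is a multiset: the conclusion's succedent
-- is taken up to permutation.  Γ is a set: all conditions on Γ are
-- membership-based, and "Γ, a" is written a ∷ Γ.

data Der (O : Ontology) : ℕ → Seq → Set where
  r-id   : ∀ {h Γ Δc Δ x A} → IsSeq O (Γ ⊢ Δc) →
           Δc ↭ ((x , at A) ∷ (x , nat A) ∷ Δ) →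
           Der O (suc h) (Γ ⊢ Δc)
  r-id≐  : ∀ {h Γ Δ x y} → IsSeq O (Γ ⊢ Δ) →
           neq x y ∈ Γ → x ≐*[ Γ ] y →
           Der O (suc h) (Γ ⊢ Δ)
  r-s≐   : ∀ {h Γ Δc Δ x y C} → IsSeq O (Γ ⊢ Δc) →
           Δc ↭ ((x , C) ∷ Δ) → Literal C → x ≐*[ Γ ] y →
           Der O h (Γ ⊢ ((x , C) ∷ (y , C) ∷ Δ)) →
           Der O (suc h) (Γ ⊢ Δc)
  r-⊔    : ∀ {h Γ Δc Δ x C D} → IsSeq O (Γ ⊢ Δc) →
           Δc ↭ ((x , C ⊔ D) ∷ Δ) →
           Der O h (Γ ⊢ ((x , C) ∷ (x , D) ∷ Δ)) →
           Der O (suc h) (Γ ⊢ Δc)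
  r-⊓    : ∀ {h Γ Δc Δ x C D} → IsSeq O (Γ ⊢ Δc) →
           Δc ↭ ((x , C ⊓ D) ∷ Δ) →
           Der O h (Γ ⊢ ((x , C) ∷ Δ)) →
           Der O h (Γ ⊢ ((x , D) ∷ Δ)) →
           Der O (suc h) (Γ ⊢ Δc)
  r-∃    : ∀ {h Γ Δc Δ x y r C} → IsSeq O (Γ ⊢ Δc) →
           Δc ↭ ((x , ex r C) ∷ Δ) → PropL O Γ x r y →
           Der O h (Γ ⊢ ((x , ex r C) ∷ (y , C) ∷ Δ)) →
           Der O (suc h) (Γ ⊢ Δc)
  r-∀    : ∀ {h Γ Δc Δ x y r C} → IsSeq O (Γ ⊢ Δc) →
           Δc ↭ ((x , all r C) ∷ Δ) → Fresh y (Γ ⊢ Δc) →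
           Der O h ((rel r x y ∷ Γ) ⊢ ((y , C) ∷ GCI O y ++ Δ)) →
           Der O (suc h) (Γ ⊢ Δc)
  r-≤    : ∀ {h Γ Δc Δ x n r C} (ys : List Label) → IsSeq O (Γ ⊢ Δc) →
           Δc ↭ ((x , atmost n r C) ∷ Δ) →
           length ys ≡ suc n → Unique ys → All (λ y → Fresh y (Γ ⊢ Δc)) ys →
           Der O h ((neqs ys ++ map (rel r x) ys ++ Γ) ⊢
                    (concat (map (λ y → (y , ¬̇ C) ∷ GCI O y) ys) ++ Δ)) →
           Der O (suc h) (Γ ⊢ Δc)
  r-≥    : ∀ {h Γ Δc Δ x n r C} (ys : Vec Label n) → IsSeq O (Γ ⊢ Δc) →
           Δc ↭ ((x , atleast n r C) ∷ Δ) →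
           (∀ i → PropL O Γ x r (lookup ys i)) →
           (∀ i → Der O h (Γ ⊢ ((lookup ys i , C) ∷ (x , atleast n r C) ∷ Δ))) →
           (∀ i j → i <ᶠ j →
              Der O h ((eq (lookup ys i) (lookup ys j) ∷ Γ) ⊢
                       ((x , atleast n r C) ∷ Δ))) →
           Der O (suc h) (Γ ⊢ Δc)

Provable : Ontology → Seq → Set
Provable O S = Σ ℕ λ h → Der O h S

open import Data.Nat using () renaming (_≟_ to _≟ℕ_)
open import Relation.Nullary using (yes; no)

[_/_]ℓ : Label → Label → Label → Label
[ x / y ]ℓ z with z ≟ℕ y
... | yes _ = x
... | no  _ = z

[_/_]a : Label → Label → SAtom → SAtom
[ x / y ]a (rel r u v) = rel r ([ x / y ]ℓ u) ([ x / y ]ℓ v)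
[ x / y ]a (eq u v)    = eq ([ x / y ]ℓ u) ([ x / y ]ℓ v)
[ x / y ]a (neq u v)   = neq ([ x / y ]ℓ u) ([ x / y ]ℓ v)

[_/_]s : Label → Label → Seq → Seq
[ x / y ]s (Γ ⊢ Δ) = map ([ x / y ]a) Γ ⊢ map (λ uC → ([ x / y ]ℓ (proj₁ uC) , proj₂ uC)) Δ

-- The delicate one is (x/y):
-- identifying labels must keep the antecedent a tree, which holds when the new label is fresh and
-- also when the two labels are r-successors of a common node; an eigenlabel that clashes with the
-- new label is first renamed apart at the same height.  The sibling case is what makes (∀) and (≤)
-- invertible, since their fresh successors can then be identified with existing ones.  Adding an
-- (in)equality between known labels, or dropping the mirror image of an inequality, changes the
-- antecedent only in ways no rule observes.  Contraction inverts a principal duplicate before using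
-- the induction hypothesis, and x : ⊤ = x : A₀ ⊔ ¬A₀ follows from (⊔) and (id).

module Submission where

open import Defs
open import Data.Empty using (⊥; ⊥-elim)
open import Data.Fin using () renaming (_<_ to _<ᶠ_)
open import Data.List using (List; []; _∷_; _++_; map; concat; concatMap; length)
open import Data.List.Extrema.Nat using (max; xs≤max)
open import Data.List.Membership.Propositional using (_∈_; _∉_; find; lose)
open import Data.List.Membership.Propositional.Properties
  using (∈-∃++; ∈-++⁺ˡ; ∈-++⁺ʳ; ∈-++⁻; ∈-map⁺; ∈-map⁻)
open import Data.List.Properties using (++-assoc; map-++; length-map; map-cong; map-id-local)
open import Data.List.Relation.Binary.Permutation.Propositional
  using (_↭_; ↭-refl; ↭-sym; ↭-trans; prep; swap)
import Data.List.Relation.Binary.Permutation.Propositional.Properties as PP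
open import Data.List.Relation.Unary.All using (All; []; _∷_)
import Data.List.Relation.Unary.All as All
import Data.List.Relation.Unary.All.Properties as AllP
import Data.List.Relation.Unary.AllPairs as AllPairs
open import Data.List.Relation.Unary.Any using (here; there)
import Data.List.Relation.Unary.Any as Any
import Data.List.Relation.Unary.Any.Properties as AnyP
open import Data.List.Relation.Unary.Unique.Propositional using (Unique)
open import Data.Nat using (ℕ; zero; suc; _≟_)
open import Data.Nat.Properties using (1+n≰n; suc-injective)
open import Data.List.Membership.DecPropositional _≟_ using (_∈?_)
open import Data.Product using (Σ; _×_; _,_; proj₁; proj₂)
open import Data.Sum using (_⊎_; inj₁; inj₂; [_,_])
import Data.Sum as Sum
open import Data.Unit using (⊤; tt)
open import Data.Vec using (Vec; lookup)
import Data.Vec as Vec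
import Data.Vec.Properties as VecP
open import Function using (id; _∘_)
open import Relation.Nullary using (Dec; yes; no; _⊎-dec_)
open import Relation.Binary.PropositionalEquality hiding ([_])
open ≡-Reasoning
open import Relation.Binary.Construct.Closure.ReflexiveTransitive using (ε; _◅_; _◅◅_)

∷↭∷-inv : ∀ {A : Set} {x y : A} {xs ys} → x ∷ xs ↭ y ∷ ys →
  (y ≡ x × xs ↭ ys) ⊎ Σ (List A) λ zs → (xs ↭ y ∷ zs) × (ys ↭ x ∷ zs)
∷↭∷-inv {x = x} {y} π with PP.∈-resp-↭ (↭-sym π) (here refl)
... | here refl = inj₁ (refl , PP.drop-∷ π)
... | there y∈xs with ∈-∃++ y∈xs
... | us , vs , refl =
  inj₂ (us ++ vs , PP.shift y us vs , ↭-sym (PP.drop-mid (x ∷ us) [] π))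

∷∷↭∷-inv : ∀ {A : Set} {x y : A} {xs ys} → x ∷ x ∷ xs ↭ y ∷ ys →
  (y ≡ x × ys ↭ x ∷ xs) ⊎ Σ (List A) λ zs → (ys ↭ x ∷ x ∷ zs) × (xs ↭ y ∷ zs)
∷∷↭∷-inv π with ∷↭∷-inv π
... | inj₁ (e , ρ) = inj₁ (e , ↭-sym ρ)
... | inj₂ (zs , ρ , σ) with ∷↭∷-inv ρ
... | inj₁ (e , τ) = inj₁ (e , ↭-trans σ (prep _ (↭-sym τ)))
... | inj₂ (zs′ , τ , υ) = inj₂ (zs′ , ↭-trans σ (prep _ υ) , τ)

∈⇒↭∷ : ∀ {A : Set} {x : A} {xs} → x ∈ xs → Σ (List A) λ ys → xs ↭ x ∷ ys
∈⇒↭∷ x∈xs with ∈-∃++ x∈xs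
... | us , vs , refl = us ++ vs , PP.shift _ us vs

∈⇒↭∷∷ : ∀ {A : Set} {x y : A} {xs} → x ∈ xs → y ∈ xs → x ≢ y → Σ (List A) λ ys → xs ↭ x ∷ y ∷ ys
∈⇒↭∷∷ x∈xs y∈xs x≢y with ∈⇒↭∷ x∈xs
... | ys , π with PP.∈-resp-↭ π y∈xs
... | here e = ⊥-elim (x≢y (sym e))
... | there y∈ys with ∈⇒↭∷ y∈ys
... | zs , ρ = zs , ↭-trans π (prep _ ρ)

↭-prep-swap : ∀ {A : Set} {x y : A} {xs ys} → xs ↭ y ∷ ys → x ∷ xs ↭ y ∷ x ∷ ys
↭-prep-swap π = ↭-trans (prep _ π) (swap _ _ ↭-refl)

↭-++-pull : ∀ {A : Set} {x : A} zs {xs ys} → xs ↭ x ∷ ys → zs ++ xs ↭ x ∷ zs ++ ys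
↭-++-pull zs π = ↭-trans (PP.++⁺ˡ zs π) (PP.shift _ zs _)

↭-++-pull₂ : ∀ {A : Set} {x : A} zs {xs ys} → xs ↭ x ∷ x ∷ ys → zs ++ xs ↭ x ∷ x ∷ zs ++ ys
↭-++-pull₂ zs π = ↭-trans (↭-++-pull zs π) (prep _ (↭-++-pull zs ↭-refl))

↭-++-push : ∀ {A : Set} {x : A} zs ys → x ∷ zs ++ ys ↭ zs ++ x ∷ ys
↭-++-push zs ys = ↭-sym (PP.shift _ zs ys)

atmostSide : Ontology → Concept → List Label → List LConcept
atmostSide O C ys = concat (map (λ y → (y , ¬̇ C) ∷ GCI O y) ys)

AllPremise : Ontology → Role → Label → Label → Concept → List SAtom → List LConcept → Seq
AllPremise O r x y C Γ Δ = (rel r x y ∷ Γ) ⊢ ((y , C) ∷ GCI O y ++ Δ)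

AtmostPremise : Ontology → Role → Label → Concept → List Label → List SAtom → List LConcept → Seq
AtmostPremise O r x C ys Γ Δ = (neqs ys ++ map (rel r x) ys ++ Γ) ⊢ (atmostSide O C ys ++ Δ)

∈LabC-resp-↭ : ∀ {v Δ Δ'} → Δ ↭ Δ' → v ∈LabC Δ → v ∈LabC Δ'
∈LabC-resp-↭ = PP.Any-resp-↭

∈LabC-↭∷ : ∀ {v Δc x C Δ} → Δc ↭ (x , C) ∷ Δ → v ∈LabC Δc → x ≡ v ⊎ v ∈LabC Δ
∈LabC-↭∷ π l with ∈LabC-resp-↭ π l
... | here e = inj₁ e
... | there l' = inj₂ l'

∈LabC-++⁻ : ∀ {v} Δ {Δ'} → v ∈LabC (Δ ++ Δ') → v ∈LabC Δ ⊎ v ∈LabC Δ'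
∈LabC-++⁻ = AnyP.++⁻

∈LabC-++⁺ˡ : ∀ {v} {Δ Δ' : List LConcept} → v ∈LabC Δ → v ∈LabC (Δ ++ Δ')
∈LabC-++⁺ˡ = AnyP.++⁺ˡ

∈LabC-++⁺ʳ : ∀ {v} (Δ : List LConcept) {Δ'} → v ∈LabC Δ' → v ∈LabC (Δ ++ Δ')
∈LabC-++⁺ʳ = AnyP.++⁺ʳ

∈LabA-++⁻ : ∀ {v} Γ {Γ'} → v ∈LabA (Γ ++ Γ') → v ∈LabA Γ ⊎ v ∈LabA Γ'
∈LabA-++⁻ = AnyP.++⁻

∈LabA-++⁺ˡ : ∀ {v} {Γ Γ' : List SAtom} → v ∈LabA Γ → v ∈LabA (Γ ++ Γ')
∈LabA-++⁺ˡ = AnyP.++⁺ˡ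

∈LabA-++⁺ʳ : ∀ {v} (Γ : List SAtom) {Γ'} → v ∈LabA Γ' → v ∈LabA (Γ ++ Γ')
∈LabA-++⁺ʳ = AnyP.++⁺ʳ

∈LabA-mono : ∀ {Γ Γ' : List SAtom} → (∀ {a} → a ∈ Γ → a ∈ Γ') → ∀ {v} → v ∈LabA Γ → v ∈LabA Γ'
∈LabA-mono Γ⊆Γ' l with find l
... | _ , a∈Γ , o = lose (Γ⊆Γ' a∈Γ) o

≢[]⇒∈LabA : ∀ {Γ : List SAtom} → Γ ≢ [] → Σ Label λ v → v ∈LabA Γ
≢[]⇒∈LabA {[]} ne = ⊥-elim (ne refl)
≢[]⇒∈LabA {rel r x y ∷ Γ} ne = x , here occ-rel₁
≢[]⇒∈LabA {eq x y ∷ Γ} ne = x , here occ-eq₁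
≢[]⇒∈LabA {neq x y ∷ Γ} ne = x , here occ-neq₁

∈LabA⇒≢[] : ∀ {Γ : List SAtom} {v} → v ∈LabA Γ → Γ ≢ []
∈LabA⇒≢[] (here _) ()
∈LabA⇒≢[] (there _) ()

∈LabC-GCI⁻ : ∀ {O y v} → v ∈LabC GCI O y → v ≡ y
∈LabC-GCI⁻ {O} {y} l with find l
... | _ , i , e with ∈-map⁻ (λ C → (y , ¬̇ C)) i
... | C , _ , refl = sym e

∈LabC-atmostSide⁻ : ∀ {O C v} ys → v ∈LabC atmostSide O C ys → v ∈ ys
∈LabC-atmostSide⁻ (y ∷ ys) (here refl) = here refl
∈LabC-atmostSide⁻ {O} {C} (y ∷ ys) (there l) with ∈LabC-++⁻ (GCI O y) l
... | inj₁ k = here (∈LabC-GCI⁻ {O} k)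
... | inj₂ k = there (∈LabC-atmostSide⁻ {O} {C} ys k)

∈LabC-atmostSide⁺ : ∀ {O C y} ys → y ∈ ys → y ∈LabC atmostSide O C ys
∈LabC-atmostSide⁺ (y ∷ ys) (here refl) = here refl
∈LabC-atmostSide⁺ {O} {C} (z ∷ ys) (there i) =
  there (∈LabC-++⁺ʳ (GCI O z) (∈LabC-atmostSide⁺ {O} {C} ys i))

∈LabA-neqs⁻ : ∀ {v} ys → v ∈LabA neqs ys → v ∈ ys
∈LabA-neqs⁻ (y ∷ ys) l with ∈LabA-++⁻ (map (neq y) ys) l
... | inj₂ k = there (∈LabA-neqs⁻ ys k)
... | inj₁ k with find k
...   | _ , i , o with ∈-map⁻ (neq y) i
...     | z , z∈ys , refl with o
...       | occ-neq₁ = here refl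
...       | occ-neq₂ = there z∈ys

∈LabA-rels⁻ : ∀ {v r x} ys → v ∈LabA map (rel r x) ys → v ≡ x ⊎ v ∈ ys
∈LabA-rels⁻ (y ∷ ys) (here occ-rel₁) = inj₁ refl
∈LabA-rels⁻ (y ∷ ys) (here occ-rel₂) = inj₂ (here refl)
∈LabA-rels⁻ (y ∷ ys) (there l) = Sum.map₂ there (∈LabA-rels⁻ ys l)

Γ⊆atmostAnte : ∀ {r x Γ} ys {a} → a ∈ Γ → a ∈ neqs ys ++ map (rel r x) ys ++ Γ
Γ⊆atmostAnte {r} {x} ys = ∈-++⁺ʳ (neqs ys) ∘ ∈-++⁺ʳ (map (rel r x) ys)

rel∈atmostAnte : ∀ {r x y Γ} ys → y ∈ ys → rel r x y ∈ neqs ys ++ map (rel r x) ys ++ Γ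
rel∈atmostAnte {r} {x} ys y∈ = ∈-++⁺ʳ (neqs ys) (∈-++⁺ˡ (∈-map⁺ (rel r x) y∈))

source∈atmostAnte : ∀ {n x r} {Γ : List SAtom} ys → length ys ≡ suc n →
  x ∈LabA (neqs ys ++ map (rel r x) ys ++ Γ)
source∈atmostAnte ys@(_ ∷ _) _ = lose (rel∈atmostAnte ys (here refl)) occ-rel₁

∈Lab-premise-elim : ∀ {P : Label → Set} {Γ Δc x C Δ} A → Δc ↭ (x , C) ∷ Δ →
  (∀ {v} → v ∈LabA Γ → P v) → (∀ {v} → v ∈LabC A → P v) → (∀ {v} → v ∈LabC Δc → P v) →
  ∀ {v} → v ∈Lab (Γ ⊢ (A ++ Δ)) → P v
∈Lab-premise-elim A π hΓ hA hΔ (inj₁ l) = hΓ l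
∈Lab-premise-elim A π hΓ hA hΔ (inj₂ l) with ∈LabC-++⁻ A l
... | inj₁ k = hA k
... | inj₂ k = hΔ (∈LabC-resp-↭ (↭-sym π) (there k))

OccA? : ∀ v t → Dec (OccA v t)
OccA? v (rel r x y) with x ≟ v | y ≟ v
... | yes refl | _ = yes occ-rel₁
... | no _ | yes refl = yes occ-rel₂
... | no n₁ | no n₂ = no λ { occ-rel₁ → n₁ refl ; occ-rel₂ → n₂ refl }
OccA? v (eq x y) with x ≟ v | y ≟ v
... | yes refl | _ = yes occ-eq₁
... | no _ | yes refl = yes occ-eq₂
... | no n₁ | no n₂ = no λ { occ-eq₁ → n₁ refl ; occ-eq₂ → n₂ refl }
OccA? v (neq x y) with x ≟ v | y ≟ v
... | yes refl | _ = yes occ-neq₁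
... | no _ | yes refl = yes occ-neq₂
... | no n₁ | no n₂ = no λ { occ-neq₁ → n₁ refl ; occ-neq₂ → n₂ refl }

_∈Lab?_ : ∀ v S → Dec (v ∈Lab S)
v ∈Lab? (Γ ⊢ Δ) = Any.any? (OccA? v) Γ ⊎-dec Any.any? (λ yC → proj₁ yC ≟ v) Δ

atomLabels : SAtom → List Label
atomLabels (rel _ u v) = u ∷ v ∷ []
atomLabels (eq u v) = u ∷ v ∷ []
atomLabels (neq u v) = u ∷ v ∷ []

seqLabels : Seq → List Label
seqLabels (Γ ⊢ Δ) = concatMap atomLabels Γ ++ map proj₁ Δ

OccA⇒∈atomLabels : ∀ {v t} → OccA v t → v ∈ atomLabels t
OccA⇒∈atomLabels occ-rel₁ = here refl
OccA⇒∈atomLabels occ-rel₂ = there (here refl)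
OccA⇒∈atomLabels occ-eq₁ = here refl
OccA⇒∈atomLabels occ-eq₂ = there (here refl)
OccA⇒∈atomLabels occ-neq₁ = here refl
OccA⇒∈atomLabels occ-neq₂ = there (here refl)

∈Lab⇒∈seqLabels : ∀ {v S} → v ∈Lab S → v ∈ seqLabels S
∈Lab⇒∈seqLabels {S = Γ ⊢ Δ} (inj₁ l) = ∈-++⁺ˡ (∈LabA⇒∈ Γ l)
  where
  ∈LabA⇒∈ : ∀ Γ → _ ∈LabA Γ → _ ∈ concatMap atomLabels Γ
  ∈LabA⇒∈ (t ∷ _) (here o) = ∈-++⁺ˡ (OccA⇒∈atomLabels o)
  ∈LabA⇒∈ (t ∷ Γ) (there l) = ∈-++⁺ʳ (atomLabels t) (∈LabA⇒∈ Γ l)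
∈Lab⇒∈seqLabels {S = Γ ⊢ Δ} (inj₂ l) = ∈-++⁺ʳ (concatMap atomLabels Γ) (AnyP.map⁺ (Any.map sym l))

fresh-label : ∀ S → Σ Label λ w → Fresh w S
fresh-label S = suc (max 0 (seqLabels S)) , λ l → 1+n≰n (All.lookup (xs≤max 0 _) (∈Lab⇒∈seqLabels l))

WFC-¬̇ : ∀ {R C} → WFC R C → WFC R (¬̇ C)
WFC-¬̇ wf-at = wf-nat
WFC-¬̇ wf-nat = wf-at
WFC-¬̇ (wf-⊔ a b) = wf-⊓ (WFC-¬̇ a) (WFC-¬̇ b)
WFC-¬̇ (wf-⊓ a b) = wf-⊔ (WFC-¬̇ a) (WFC-¬̇ b)
WFC-¬̇ (wf-ex a) = wf-all (WFC-¬̇ a)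
WFC-¬̇ (wf-all a) = wf-ex (WFC-¬̇ a)
WFC-¬̇ (wf-atmost s a) = wf-atleast s a
WFC-¬̇ (wf-atleast {n = zero} s a) = wf-⊓ wf-at wf-nat
WFC-¬̇ (wf-atleast {n = suc n} s a) = wf-atmost s a

≐*-sym : ∀ {Γ x y} → x ≐*[ Γ ] y → y ≐*[ Γ ] x
≐*-sym ε = ε
≐*-sym (fwd e ◅ s) = ≐*-sym s ◅◅ (bwd e ◅ ε)
≐*-sym (bwd e ◅ s) = ≐*-sym s ◅◅ (fwd e ◅ ε)

≐*-map : ∀ {Γ Γ'} → (∀ {a b} → eq a b ∈ Γ → a ≐*[ Γ' ] b) → ∀ {x y} → x ≐*[ Γ ] y → x ≐*[ Γ' ] y
≐*-map f ε = ε
≐*-map f (fwd e ◅ s) = f e ◅◅ ≐*-map f s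
≐*-map f (bwd e ◅ s) = ≐*-sym (f e) ◅◅ ≐*-map f s

≐*-mono : ∀ {Γ Γ'} → (∀ {a} → a ∈ Γ → a ∈ Γ') → ∀ {x y} → x ≐*[ Γ ] y → x ≐*[ Γ' ] y
≐*-mono Γ⊆Γ' = ≐*-map (λ e → fwd (Γ⊆Γ' e) ◅ ε)

≐*-target : ∀ {Γ x y} → x ≐*[ Γ ] y → x ≡ y ⊎ y ∈LabA Γ
≐*-target ε = inj₁ refl
≐*-target (fwd e ◅ s) with ≐*-target s
... | inj₁ refl = inj₂ (lose e occ-eq₂)
... | inj₂ l = inj₂ l
≐*-target (bwd e ◅ s) with ≐*-target s
... | inj₁ refl = inj₂ (lose e occ-eq₁)
... | inj₂ l = inj₂ l

PPath-map : ∀ {Γ Γ'} → (∀ {a b} → eq a b ∈ Γ → a ≐*[ Γ' ] b) →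
  (∀ {r a b} → rel r a b ∈ Γ → rel r a b ∈ Γ') →
  ∀ {x S y} → PPath Γ x S y → PPath Γ' x S y
PPath-map fe fr (p-nil e) = p-nil (≐*-map fe e)
PPath-map fe fr (p-fwd e r p) = p-fwd (≐*-map fe e) (fr r) (PPath-map fe fr p)
PPath-map fe fr (p-bwd e r p) = p-bwd (≐*-map fe e) (fr r) (PPath-map fe fr p)

PPath-target : ∀ {Γ x S y} → PPath Γ x S y → x ≡ y ⊎ y ∈LabA Γ
PPath-target (p-nil e) = ≐*-target e
PPath-target (p-fwd e r p) with PPath-target p
... | inj₁ refl = inj₂ (lose r occ-rel₂)
... | inj₂ l = inj₂ l
PPath-target (p-bwd e r p) with PPath-target p
... | inj₁ refl = inj₂ (lose r occ-rel₁)
... | inj₂ l = inj₂ l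

Reach-mono : ∀ {Γ Γ'} → (∀ {r a b} → rel r a b ∈ Γ → rel r a b ∈ Γ') →
  ∀ {x y} → Reach Γ x y → Reach Γ' x y
Reach-mono f here = here
Reach-mono f (step r p) = step (f r) (Reach-mono f p)

module _ (f : Label → Label) where

  mapAtom : SAtom → SAtom
  mapAtom (rel r u v) = rel r (f u) (f v)
  mapAtom (eq u v) = eq (f u) (f v)
  mapAtom (neq u v) = neq (f u) (f v)

  mapLC : LConcept → LConcept
  mapLC (u , C) = f u , C

  mapAnte : List SAtom → List SAtom
  mapAnte = map mapAtom

  mapSucc : List LConcept → List LConcept
  mapSucc = map mapLC

  mapSeq : Seq → Seq
  mapSeq (Γ ⊢ Δ) = mapAnte Γ ⊢ mapSucc Δ

  ≐*-image : ∀ {Γ x y} → x ≐*[ Γ ] y → f x ≐*[ mapAnte Γ ] f y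
  ≐*-image ε = ε
  ≐*-image (fwd e ◅ s) = fwd (∈-map⁺ mapAtom e) ◅ ≐*-image s
  ≐*-image (bwd e ◅ s) = bwd (∈-map⁺ mapAtom e) ◅ ≐*-image s

  PPath-image : ∀ {Γ x S y} → PPath Γ x S y → PPath (mapAnte Γ) (f x) S (f y)
  PPath-image (p-nil e) = p-nil (≐*-image e)
  PPath-image (p-fwd e r p) = p-fwd (≐*-image e) (∈-map⁺ mapAtom r) (PPath-image p)
  PPath-image (p-bwd e r p) = p-bwd (≐*-image e) (∈-map⁺ mapAtom r) (PPath-image p)

  PropL-image : ∀ {O Γ x r y} → PropL O Γ x r y → PropL O (mapAnte Γ) (f x) r (f y)
  PropL-image (S , S∈L , p) = S , S∈L , PPath-image p

  Reach-image : ∀ {Γ x y} → Reach Γ x y → Reach (mapAnte Γ) (f x) (f y)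
  Reach-image here = here
  Reach-image (step r p) = step (∈-map⁺ mapAtom r) (Reach-image p)

  OccA-image : ∀ {u t} → OccA u t → OccA (f u) (mapAtom t)
  OccA-image occ-rel₁ = occ-rel₁
  OccA-image occ-rel₂ = occ-rel₂
  OccA-image occ-eq₁ = occ-eq₁
  OccA-image occ-eq₂ = occ-eq₂
  OccA-image occ-neq₁ = occ-neq₁
  OccA-image occ-neq₂ = occ-neq₂

  OccA-preimage : ∀ {v} t → OccA v (mapAtom t) → Σ Label λ u → OccA u t × v ≡ f u
  OccA-preimage (rel r u w) occ-rel₁ = u , occ-rel₁ , refl
  OccA-preimage (rel r u w) occ-rel₂ = w , occ-rel₂ , refl
  OccA-preimage (eq u w) occ-eq₁ = u , occ-eq₁ , refl
  OccA-preimage (eq u w) occ-eq₂ = w , occ-eq₂ , refl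
  OccA-preimage (neq u w) occ-neq₁ = u , occ-neq₁ , refl
  OccA-preimage (neq u w) occ-neq₂ = w , occ-neq₂ , refl

  ∈LabA-image : ∀ {Γ u} → u ∈LabA Γ → f u ∈LabA mapAnte Γ
  ∈LabA-image (here o) = here (OccA-image o)
  ∈LabA-image (there l) = there (∈LabA-image l)

  ∈LabA-preimage : ∀ {Γ v} → v ∈LabA mapAnte Γ → Σ Label λ u → u ∈LabA Γ × v ≡ f u
  ∈LabA-preimage {t ∷ Γ} (here o) with OccA-preimage t o
  ... | u , o' , e = u , here o' , e
  ∈LabA-preimage {t ∷ Γ} (there l) with ∈LabA-preimage l
  ... | u , l' , e = u , there l' , e

  ∈LabC-image : ∀ {Δ u} → u ∈LabC Δ → f u ∈LabC mapSucc Δ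
  ∈LabC-image (here refl) = here refl
  ∈LabC-image (there l) = there (∈LabC-image l)

  ∈LabC-preimage : ∀ {Δ v} → v ∈LabC mapSucc Δ → Σ Label λ u → u ∈LabC Δ × v ≡ f u
  ∈LabC-preimage {t ∷ Δ} (here refl) = proj₁ t , here refl , refl
  ∈LabC-preimage {t ∷ Δ} (there l) with ∈LabC-preimage l
  ... | u , l' , e = u , there l' , e

  ∈Lab-preimage : ∀ {S v} → v ∈Lab mapSeq S → Σ Label λ u → u ∈Lab S × v ≡ f u
  ∈Lab-preimage {_ ⊢ _} (inj₁ l) with ∈LabA-preimage l
  ... | u , l' , e = u , inj₁ l' , e
  ∈Lab-preimage {_ ⊢ _} (inj₂ l) with ∈LabC-preimage l
  ... | u , l' , e = u , inj₂ l' , e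

  -- Identifying two r-successors of the same node merges two edges into one,
  -- so the image of a tree is again a tree.
  MergesOnlySiblings : List SAtom → Set
  MergesOnlySiblings Γ = ∀ {u v} → u ∈LabA Γ → v ∈LabA Γ → f u ≡ f v →
    u ≡ v ⊎ Σ Role λ r → Σ Label λ x → rel r x u ∈ Γ × rel r x v ∈ Γ

  rel-preimage : ∀ {Γ r z v} → rel r z v ∈ mapAnte Γ → Σ Label λ z₀ → Σ Label λ v₀ →
    rel r z₀ v₀ ∈ Γ × z ≡ f z₀ × v ≡ f v₀
  rel-preimage i with ∈-map⁻ mapAtom i
  ... | rel r z₀ v₀ , j , refl = z₀ , v₀ , j , refl , refl
  ... | eq _ _ , _ , ()
  ... | neq _ _ , _ , ()

  IsTreeRootedAt-image : ∀ {Γ ρ} → IsTreeRootedAt Γ ρ → MergesOnlySiblings Γ →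
    IsTreeRootedAt (mapAnte Γ) (f ρ)
  IsTreeRootedAt-image {Γ} {ρ} (ρ∈Γ , rootless , parent , reach) merge =
    ∈LabA-image ρ∈Γ , rootless' , parent' , reach'
    where
    rootless' : ∀ r z → rel r z (f ρ) ∉ mapAnte Γ
    rootless' r z i with rel-preimage i
    ... | z₀ , v₀ , j , _ , e with merge (lose j occ-rel₂) ρ∈Γ (sym e)
    ...   | inj₁ refl = rootless r z₀ j
    ...   | inj₂ (r' , x' , _ , k) = rootless r' x' k
    parent' : ∀ v' → v' ∈LabA mapAnte Γ → v' ≢ f ρ → _
    parent' v' l v'≢fρ with ∈LabA-preimage l
    ... | v , v∈Γ , refl with parent v v∈Γ (λ { refl → v'≢fρ refl })
    ...   | r , z , i , unique = r , f z , ∈-map⁺ mapAtom i , unique'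
      where
      unique' : ∀ r' z' → rel r' z' (f v) ∈ mapAnte Γ → r' ≡ r × z' ≡ f z
      unique' r' z' i' with rel-preimage i'
      ... | z₀ , v₀ , j , refl , e with merge (lose j occ-rel₂) v∈Γ (sym e)
      ...   | inj₁ refl with unique r' z₀ j
      ...     | refl , refl = refl , refl
      unique' r' z' i' | z₀ , v₀ , j , refl , e | inj₂ (r'' , x'' , k₁ , k₂) with unique r'' x'' k₂
      ...     | refl , refl with parent v₀ (lose j occ-rel₂) (λ { refl → rootless _ _ j })
      ...       | _ , _ , _ , unique₀ with unique₀ r' z₀ j | unique₀ r'' x'' k₁
      ...         | refl , refl | refl , refl = refl , refl
    reach' : ∀ v' → v' ∈LabA mapAnte Γ → Reach (mapAnte Γ) (f ρ) v'
    reach' v' l with ∈LabA-preimage l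
    ... | v , v∈Γ , refl = Reach-image (reach v v∈Γ)

  mapAnte-≢[] : ∀ {Γ : List SAtom} → Γ ≢ [] → mapAnte Γ ≢ []
  mapAnte-≢[] {[]} ne = ne
  mapAnte-≢[] {_ ∷ _} ne ()

  IsSeq-image : ∀ {O Γ Δ} → IsSeq O (Γ ⊢ Δ) → MergesOnlySiblings Γ → IsSeq O (mapSeq (Γ ⊢ Δ))
  IsSeq-image (tree , wf , labels) merge = tree' tree , AllP.map⁺ wf , labels' labels
    where
    tree' : FormsTree _ → FormsTree _
    tree' (inj₁ refl) = inj₁ refl
    tree' (inj₂ (ρ , t)) = inj₂ (f ρ , IsTreeRootedAt-image t merge)
    labels' : _ → _
    labels' (inj₁ (refl , z , z∈Δ , only-z)) = inj₁ (refl , f z , ∈LabC-image z∈Δ ,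
      λ y y∈ → let (u , u∈Δ , e) = ∈LabC-preimage y∈ in trans e (cong f (only-z u u∈Δ)))
    labels' (inj₂ (ne , ⊆Γ)) = inj₂ (mapAnte-≢[] ne ,
      λ y y∈ → let (u , u∈Δ , e) = ∈LabC-preimage y∈
               in subst (_∈LabA _) (sym e) (∈LabA-image (⊆Γ u u∈Δ)))

  mapAnte-neqs : ∀ ys → mapAnte (neqs ys) ≡ neqs (map f ys)
  mapAnte-neqs [] = refl
  mapAnte-neqs (y ∷ ys) =
    trans (map-++ mapAtom (map (neq y) ys) (neqs ys)) (cong₂ _++_ (row ys) (mapAnte-neqs ys))
    where
    row : ∀ zs → mapAnte (map (neq y) zs) ≡ map (neq (f y)) (map f zs)
    row [] = refl
    row (z ∷ zs) = cong (neq (f y) (f z) ∷_) (row zs)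

  mapAnte-rels : ∀ r x ys → mapAnte (map (rel r x) ys) ≡ map (rel r (f x)) (map f ys)
  mapAnte-rels r x [] = refl
  mapAnte-rels r x (y ∷ ys) = cong (rel r (f x) (f y) ∷_) (mapAnte-rels r x ys)

  mapSucc-GCI : ∀ O y → mapSucc (GCI O y) ≡ GCI O (f y)
  mapSucc-GCI O y = go (tbox O)
    where
    go : ∀ Cs → mapSucc (map (λ C → (y , ¬̇ C)) Cs) ≡ map (λ C → (f y , ¬̇ C)) Cs
    go [] = refl
    go (C ∷ Cs) = cong (_ ∷_) (go Cs)

  mapSucc-atmostSide : ∀ O C ys → mapSucc (atmostSide O C ys) ≡ atmostSide O C (map f ys)
  mapSucc-atmostSide O C [] = refl
  mapSucc-atmostSide O C (y ∷ ys) = trans (map-++ mapLC ((y , ¬̇ C) ∷ GCI O y) _)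
    (cong₂ (λ Δ Δ' → (f y , ¬̇ C) ∷ Δ ++ Δ') (mapSucc-GCI O y) (mapSucc-atmostSide O C ys))

  mapSeq-AllPremise : ∀ O r x y C Γ Δ →
    mapSeq (AllPremise O r x y C Γ Δ) ≡ AllPremise O r (f x) (f y) C (mapAnte Γ) (mapSucc Δ)
  mapSeq-AllPremise O r x y C Γ Δ = cong (λ Δ' → (rel r (f x) (f y) ∷ mapAnte Γ) ⊢ ((f y , C) ∷ Δ'))
    (trans (map-++ mapLC (GCI O y) Δ) (cong (_++ mapSucc Δ) (mapSucc-GCI O y)))

  mapSeq-AtmostPremise : ∀ O r x C ys Γ Δ →
    mapSeq (AtmostPremise O r x C ys Γ Δ) ≡ AtmostPremise O r (f x) C (map f ys) (mapAnte Γ) (mapSucc Δ)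
  mapSeq-AtmostPremise O r x C ys Γ Δ = cong₂ _⊢_
    (begin
      mapAnte (neqs ys ++ map (rel r x) ys ++ Γ)
    ≡⟨ map-++ mapAtom (neqs ys) _ ⟩
      mapAnte (neqs ys) ++ mapAnte (map (rel r x) ys ++ Γ)
    ≡⟨ cong₂ _++_ (mapAnte-neqs ys) (map-++ mapAtom (map (rel r x) ys) Γ) ⟩
      neqs (map f ys) ++ mapAnte (map (rel r x) ys) ++ mapAnte Γ
    ≡⟨ cong (λ Γ' → neqs (map f ys) ++ Γ' ++ mapAnte Γ) (mapAnte-rels r x ys) ⟩
      neqs (map f ys) ++ map (rel r (f x)) (map f ys) ++ mapAnte Γ
    ∎)
    (trans (map-++ mapLC (atmostSide O C ys) Δ) (cong (_++ mapSucc Δ) (mapSucc-atmostSide O C ys)))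

  mapAnte-id : ∀ {Γ} → (∀ {u} → u ∈LabA Γ → f u ≡ u) → mapAnte Γ ≡ Γ
  mapAnte-id {[]} fix = refl
  mapAnte-id {rel r x y ∷ Γ} fix =
    cong₂ _∷_ (cong₂ (rel r) (fix (here occ-rel₁)) (fix (here occ-rel₂))) (mapAnte-id (fix ∘ there))
  mapAnte-id {eq x y ∷ Γ} fix =
    cong₂ _∷_ (cong₂ eq (fix (here occ-eq₁)) (fix (here occ-eq₂))) (mapAnte-id (fix ∘ there))
  mapAnte-id {neq x y ∷ Γ} fix =
    cong₂ _∷_ (cong₂ neq (fix (here occ-neq₁)) (fix (here occ-neq₂))) (mapAnte-id (fix ∘ there))

  mapSucc-id : ∀ {Δ} → (∀ {u} → u ∈LabC Δ → f u ≡ u) → mapSucc Δ ≡ Δ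
  mapSucc-id {[]} fix = refl
  mapSucc-id {(x , C) ∷ Δ} fix = cong₂ _∷_ (cong (_, C) (fix (here refl))) (mapSucc-id (fix ∘ there))

[/]ℓ-hit : ∀ a b → [ a / b ]ℓ b ≡ a
[/]ℓ-hit a b with b ≟ b
... | yes _ = refl
... | no b≢b = ⊥-elim (b≢b refl)

[/]ℓ-miss : ∀ {a b u} → u ≢ b → [ a / b ]ℓ u ≡ u
[/]ℓ-miss {a} {b} {u} u≢b with u ≟ b
... | yes e = ⊥-elim (u≢b e)
... | no _ = refl

[/]ℓ-cases : ∀ a b u → (u ≡ b × [ a / b ]ℓ u ≡ a) ⊎ (u ≢ b × [ a / b ]ℓ u ≡ u)
[/]ℓ-cases a b u with u ≟ b
... | yes e = inj₁ (e , refl)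
... | no u≢b = inj₂ (u≢b , refl)

[/]s≡mapSeq : ∀ a b S → [ a / b ]s S ≡ mapSeq [ a / b ]ℓ S
[/]s≡mapSeq a b (Γ ⊢ Δ) =
  cong (_⊢ mapSucc [ a / b ]ℓ Δ) (map-cong (λ { (rel _ _ _) → refl ; (eq _ _) → refl ; (neq _ _) → refl }) Γ)

Substitutable : Label → Label → Seq → Set
Substitutable a b S =
  Fresh a S ⊎ Σ Role λ r → Σ Label λ x → rel r x a ∈ ante S × rel r x b ∈ ante S

Substitutable⇒MergesOnlySiblings : ∀ {a b Γ Δ} → Substitutable a b (Γ ⊢ Δ) →
  MergesOnlySiblings [ a / b ]ℓ Γ
Substitutable⇒MergesOnlySiblings {a} {b} sa {u} {v} u∈Γ v∈Γ e with [/]ℓ-cases a b u | [/]ℓ-cases a b v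
... | inj₁ (refl , _) | inj₁ (refl , _) = inj₁ refl
... | inj₂ (_ , e₁) | inj₂ (_ , e₂) = inj₁ (trans (sym e₁) (trans e e₂))
... | inj₁ (refl , e₁) | inj₂ (_ , e₂) with trans (sym e₁) (trans e e₂)
...   | refl with sa
...     | inj₁ a∉S = ⊥-elim (a∉S (inj₁ v∈Γ))
...     | inj₂ (r , x , ra , rb) = inj₂ (r , x , rb , ra)
Substitutable⇒MergesOnlySiblings {a} {b} sa {u} {v} u∈Γ v∈Γ e | inj₂ (_ , e₁) | inj₁ (refl , e₂)
  with trans (sym e₁) (trans e e₂)
...   | refl with sa
...     | inj₁ a∉S = ⊥-elim (a∉S (inj₁ u∈Γ))
...     | inj₂ (r , x , ra , rb) = inj₂ (r , x , ra , rb)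

Unique-map-[/]ℓ : ∀ {w a} ys → Unique ys → w ∉ ys → Unique (map [ w / a ]ℓ ys)
Unique-map-[/]ℓ [] _ _ = AllPairs.[]
Unique-map-[/]ℓ {w} {a} (y ∷ ys) (y∉ys AllPairs.∷ u) w∉ =
  distinct ys y∉ys (w∉ ∘ there) AllPairs.∷ Unique-map-[/]ℓ ys u (w∉ ∘ there)
  where
  distinct : ∀ zs → All (y ≢_) zs → w ∉ zs → All ([ w / a ]ℓ y ≢_) (map [ w / a ]ℓ zs)
  distinct [] [] _ = []
  distinct (z ∷ zs) (y≢z ∷ y≢zs) w∉zs = y'≢z' ∷ distinct zs y≢zs (w∉zs ∘ there)
    where
    y'≢z' : [ w / a ]ℓ y ≢ [ w / a ]ℓ z
    y'≢z' e with [/]ℓ-cases w a y | [/]ℓ-cases w a z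
    ... | inj₁ (refl , _) | inj₁ (refl , _) = y≢z refl
    ... | inj₁ (refl , e₁) | inj₂ (_ , e₂) = w∉zs (here (sym (trans (sym e₂) (trans (sym e) e₁))))
    ... | inj₂ (_ , e₁) | inj₁ (refl , e₂) = w∉ (here (trans (sym e₂) (trans (sym e) e₁)))
    ... | inj₂ (_ , e₁) | inj₂ (_ , e₂) = y≢z (trans (sym e₁) (trans e e₂))

module _ (O : Ontology) where

  WFSucc : List LConcept → Set
  WFSucc = All (λ xC → WFC (rbox O) (proj₂ xC))

  Der⇒IsSeq : ∀ {h S} → Der O h S → IsSeq O S
  Der⇒IsSeq (r-id s _) = s
  Der⇒IsSeq (r-id≐ s _ _) = s
  Der⇒IsSeq (r-s≐ s _ _ _ _) = s
  Der⇒IsSeq (r-⊔ s _ _) = s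
  Der⇒IsSeq (r-⊓ s _ _ _) = s
  Der⇒IsSeq (r-∃ s _ _ _) = s
  Der⇒IsSeq (r-∀ s _ _ _) = s
  Der⇒IsSeq (r-≤ _ s _ _ _ _ _) = s
  Der⇒IsSeq (r-≥ _ s _ _ _ _) = s

  IsSeq⇒WFSucc : ∀ {Γ Δ} → IsSeq O (Γ ⊢ Δ) → WFSucc Δ
  IsSeq⇒WFSucc (_ , wf , _) = wf

  IsSeq-∈LabC⇒∈LabA : ∀ {Γ Δ v} → IsSeq O (Γ ⊢ Δ) → Γ ≢ [] → v ∈LabC Δ → v ∈LabA Γ
  IsSeq-∈LabC⇒∈LabA (_ , _ , inj₁ (e , _)) ne l = ⊥-elim (ne e)
  IsSeq-∈LabC⇒∈LabA (_ , _ , inj₂ (_ , ⊆Γ)) ne l = ⊆Γ _ l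

  IsSeq-∈Lab⇒∈LabA⊎≡ : ∀ {Γ Δ x v} → IsSeq O (Γ ⊢ Δ) → x ∈Lab (Γ ⊢ Δ) → v ∈Lab (Γ ⊢ Δ) →
    v ∈LabA Γ ⊎ v ≡ x
  IsSeq-∈Lab⇒∈LabA⊎≡ s xl (inj₁ l) = inj₁ l
  IsSeq-∈Lab⇒∈LabA⊎≡ (_ , _ , inj₂ (_ , ⊆Γ)) xl (inj₂ l) = inj₁ (⊆Γ _ l)
  IsSeq-∈Lab⇒∈LabA⊎≡ (_ , _ , inj₁ (refl , _)) (inj₁ ()) (inj₂ l)
  IsSeq-∈Lab⇒∈LabA⊎≡ (_ , _ , inj₁ (refl , _ , _ , only)) (inj₂ xl) (inj₂ l) =
    inj₂ (trans (only _ l) (sym (only _ xl)))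

  IsSeq-withSucc : ∀ {Γ Δ Δ'} → IsSeq O (Γ ⊢ Δ) → WFSucc Δ' →
    (∀ v → v ∈LabC Δ' → v ∈Lab (Γ ⊢ Δ)) → (Γ ≡ [] → Σ Label λ v → v ∈LabC Δ') →
    IsSeq O (Γ ⊢ Δ')
  IsSeq-withSucc s@(tree , _ , inj₁ (refl , _)) wf' ⊆old nonempty with nonempty refl
  ... | v , v∈Δ' = tree , wf' , inj₁ (refl , v , v∈Δ' , λ y y∈Δ' → single y y∈Δ')
    where
    single : ∀ y → y ∈LabC _ → y ≡ v
    single y y∈Δ' with IsSeq-∈Lab⇒∈LabA⊎≡ s (⊆old v v∈Δ') (⊆old y y∈Δ')
    ... | inj₁ ()
    ... | inj₂ e = e
  IsSeq-withSucc (tree , _ , inj₂ (ne , ⊆Γ)) wf' ⊆old _ =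
    tree , wf' , inj₂ (ne , λ y y∈Δ' → toA (⊆old y y∈Δ'))
    where
    toA : ∀ {y} → y ∈Lab (_ ⊢ _) → y ∈LabA _
    toA (inj₁ l) = l
    toA (inj₂ l) = ⊆Γ _ l

  IsSeq-resp-↭ : ∀ {Γ Δ Δ'} → IsSeq O (Γ ⊢ Δ) → Δ ↭ Δ' → IsSeq O (Γ ⊢ Δ')
  IsSeq-resp-↭ s π = IsSeq-withSucc s (PP.All-resp-↭ π (IsSeq⇒WFSucc s))
    (λ v l → inj₂ (∈LabC-resp-↭ (↭-sym π) l)) (nonempty s)
    where
    nonempty : IsSeq O _ → _ ≡ [] → Σ Label λ v → v ∈LabC _
    nonempty (_ , _ , inj₁ (_ , z , z∈Δ , _)) _ = z , ∈LabC-resp-↭ π z∈Δ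
    nonempty (_ , _ , inj₂ (ne , _)) e = ⊥-elim (ne e)

  Fresh-resp-↭ : ∀ {y Γ Δ Δ'} → Δ ↭ Δ' → Fresh y (Γ ⊢ Δ) → Fresh y (Γ ⊢ Δ')
  Fresh-resp-↭ π f (inj₁ l) = f (inj₁ l)
  Fresh-resp-↭ π f (inj₂ l) = f (inj₂ (∈LabC-resp-↭ (↭-sym π) l))

  Der-resp-↭ : ∀ {h Γ Δ Δ'} → Der O h (Γ ⊢ Δ) → Δ ↭ Δ' → Der O h (Γ ⊢ Δ')
  Der-resp-↭ (r-id s p) π = r-id (IsSeq-resp-↭ s π) (↭-trans (↭-sym π) p)
  Der-resp-↭ (r-id≐ s n e) π = r-id≐ (IsSeq-resp-↭ s π) n e
  Der-resp-↭ (r-s≐ s p l e d) π = r-s≐ (IsSeq-resp-↭ s π) (↭-trans (↭-sym π) p) l e d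
  Der-resp-↭ (r-⊔ s p d) π = r-⊔ (IsSeq-resp-↭ s π) (↭-trans (↭-sym π) p) d
  Der-resp-↭ (r-⊓ s p d₁ d₂) π = r-⊓ (IsSeq-resp-↭ s π) (↭-trans (↭-sym π) p) d₁ d₂
  Der-resp-↭ (r-∃ s p pr d) π = r-∃ (IsSeq-resp-↭ s π) (↭-trans (↭-sym π) p) pr d
  Der-resp-↭ (r-∀ s p f d) π = r-∀ (IsSeq-resp-↭ s π) (↭-trans (↭-sym π) p) (Fresh-resp-↭ π f) d
  Der-resp-↭ (r-≤ ys s p l u f d) π =
    r-≤ ys (IsSeq-resp-↭ s π) (↭-trans (↭-sym π) p) l u (All.map (Fresh-resp-↭ π) f) d
  Der-resp-↭ (r-≥ ys s p pr d₁ d₂) π = r-≥ ys (IsSeq-resp-↭ s π) (↭-trans (↭-sym π) p) pr d₁ d₂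

  Der-lift : ∀ {h S} → Der O h S → Der O (suc h) S
  Der-lift (r-id s p) = r-id s p
  Der-lift (r-id≐ s n e) = r-id≐ s n e
  Der-lift (r-s≐ s p l e d) = r-s≐ s p l e (Der-lift d)
  Der-lift (r-⊔ s p d) = r-⊔ s p (Der-lift d)
  Der-lift (r-⊓ s p d₁ d₂) = r-⊓ s p (Der-lift d₁) (Der-lift d₂)
  Der-lift (r-∃ s p pr d) = r-∃ s p pr (Der-lift d)
  Der-lift (r-∀ s p f d) = r-∀ s p f (Der-lift d)
  Der-lift (r-≤ ys s p l u f d) = r-≤ ys s p l u f (Der-lift d)
  Der-lift (r-≥ ys s p pr d₁ d₂) = r-≥ ys s p pr (λ i → Der-lift (d₁ i)) (λ i j i<j → Der-lift (d₂ i j i<j))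

  principal∈Lab : ∀ {Γ Δc x C Δ} → Δc ↭ (x , C) ∷ Δ → x ∈Lab (Γ ⊢ Δc)
  principal∈Lab p = inj₂ (∈LabC-resp-↭ (↭-sym p) (here refl))

  ∈LabC-lift : ∀ {Γ : List SAtom} {Δc x C Δ} A → Δc ↭ (x , C) ∷ Δ →
    x ∈Lab (Γ ⊢ (A ++ Δ)) → ∀ v → v ∈LabC Δc → v ∈Lab (Γ ⊢ (A ++ Δ))
  ∈LabC-lift A π xl v l with ∈LabC-↭∷ π l
  ... | inj₁ refl = xl
  ... | inj₂ l' = inj₂ (∈LabC-++⁺ʳ A l')

  ∈Lab-lift : ∀ {Γ Γ' : List SAtom} {Δc x C Δ} A → (∀ {v} → v ∈LabA Γ → v ∈LabA Γ') →
    Δc ↭ (x , C) ∷ Δ → x ∈Lab (Γ' ⊢ (A ++ Δ)) → ∀ {v} → v ∈Lab (Γ ⊢ Δc) → v ∈Lab (Γ' ⊢ (A ++ Δ))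
  ∈Lab-lift A Γ⊆Γ' π xl (inj₁ l) = inj₁ (Γ⊆Γ' l)
  ∈Lab-lift A Γ⊆Γ' π xl (inj₂ l) = ∈LabC-lift A π xl _ l

  -- Γ' has the tree and the labels of Γ ⊢ Δ and at least its (in)equalities, so every rule
  -- application over Γ remains one over Γ'.
  record Embeds (Γ Γ' : List SAtom) (Δ : List LConcept) : Set where
    field
      rel⇒ : ∀ {r a b} → rel r a b ∈ Γ → rel r a b ∈ Γ'
      rel⇐ : ∀ {r a b} → rel r a b ∈ Γ' → rel r a b ∈ Γ
      eq⇒  : ∀ {a b} → eq a b ∈ Γ → a ≐*[ Γ' ] b
      neq⇒ : ∀ {a b} → neq a b ∈ Γ → neq a b ∈ Γ' ⊎ neq b a ∈ Γ'
      lab⇒ : ∀ {v} → v ∈Lab (Γ ⊢ Δ) → v ∈LabA Γ'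
      lab⇐ : ∀ {v} → v ∈LabA Γ' → v ∈Lab (Γ ⊢ Δ)
  open Embeds

  IsSeq-embed : ∀ {Γ Γ' Δ} → Embeds Γ Γ' Δ → IsSeq O (Γ ⊢ Δ) → IsSeq O (Γ' ⊢ Δ)
  IsSeq-embed E (_ , wf , inj₁ (refl , z , z∈Δ , only)) =
    inj₂ (z , z∈Γ' , (λ r y i → noRel (rel⇐ E i)) , parent , reach) , wf ,
    inj₂ (∈LabA⇒≢[] z∈Γ' , λ y y∈Δ → lab⇒ E (inj₂ y∈Δ))
    where
    z∈Γ' = lab⇒ E (inj₂ z∈Δ)
    noRel : ∀ {a : SAtom} → a ∉ []
    noRel ()
    only-z : ∀ {v} → v ∈Lab ([] ⊢ _) → v ≡ z
    only-z (inj₂ l) = only _ l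
    parent : ∀ v → v ∈LabA _ → v ≢ z → _
    parent v l v≢z = ⊥-elim (v≢z (only-z (lab⇐ E l)))
    reach : ∀ v → v ∈LabA _ → Reach _ z v
    reach v l with only-z (lab⇐ E l)
    ... | refl = here
  IsSeq-embed E (inj₁ e , _ , inj₂ (ne , _)) = ⊥-elim (ne e)
  IsSeq-embed {Γ} {Γ'} {Δ} E (inj₂ (ρ , ρ∈Γ , rootless , parent , reach) , wf , inj₂ (ne , ⊆Γ)) =
    inj₂ (ρ , lab⇒ E (inj₁ ρ∈Γ) , (λ r z i → rootless r z (rel⇐ E i)) , parent' , reach') , wf ,
    inj₂ (∈LabA⇒≢[] (lab⇒ E (inj₁ (proj₂ (≢[]⇒∈LabA ne)))) , λ y y∈Δ → lab⇒ E (inj₂ y∈Δ))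
    where
    toA : ∀ {v} → v ∈Lab (Γ ⊢ Δ) → v ∈LabA Γ
    toA (inj₁ l) = l
    toA (inj₂ l) = ⊆Γ _ l
    parent' : ∀ v → v ∈LabA Γ' → v ≢ ρ → _
    parent' v l v≢ρ with parent v (toA (lab⇐ E l)) v≢ρ
    ... | r , z , i , unique = r , z , rel⇒ E i , λ r' z' i' → unique r' z' (rel⇐ E i')
    reach' : ∀ v → v ∈LabA Γ' → Reach Γ' ρ v
    reach' v l = Reach-mono (rel⇒ E) (reach v (toA (lab⇐ E l)))

  Embeds-++ˡ : ∀ {Γ Γ' Δ Δp} P → Embeds Γ Γ' Δ → IsSeq O ((P ++ Γ) ⊢ Δp) →
    (∀ v → v ∈LabC Δ → v ∈Lab ((P ++ Γ) ⊢ Δp)) →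
    (P ++ Γ ≡ [] → Σ Label λ u → u ∈LabC Δp × u ∈LabC Δ) →
    Embeds (P ++ Γ) (P ++ Γ') Δp
  Embeds-++ˡ {Γ} {Γ'} {Δ} {Δp} P E sp Δ⊆ shared = record
    { rel⇒ = λ i → [ ∈-++⁺ˡ , (λ j → ∈-++⁺ʳ P (rel⇒ E j)) ] (∈-++⁻ P i)
    ; rel⇐ = λ i → [ ∈-++⁺ˡ , (λ j → ∈-++⁺ʳ P (rel⇐ E j)) ] (∈-++⁻ P i)
    ; eq⇒ = λ i → [ (λ j → fwd (∈-++⁺ˡ j) ◅ ε) , (λ j → ≐*-mono (∈-++⁺ʳ P) (eq⇒ E j)) ] (∈-++⁻ P i)
    ; neq⇒ = λ i → [ (λ j → inj₁ (∈-++⁺ˡ j)) ,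
                     (λ j → Sum.map (∈-++⁺ʳ P) (∈-++⁺ʳ P) (neq⇒ E j)) ] (∈-++⁻ P i)
    ; lab⇒ = l⇒
    ; lab⇐ = l⇐
    }
    where
    lA⇒ : ∀ {v} → v ∈LabA (P ++ Γ) → v ∈LabA (P ++ Γ')
    lA⇒ l = [ ∈LabA-++⁺ˡ , (λ j → ∈LabA-++⁺ʳ P (lab⇒ E (inj₁ j))) ] (∈LabA-++⁻ P l)
    l⇒ : ∀ {v} → v ∈Lab ((P ++ Γ) ⊢ Δp) → v ∈LabA (P ++ Γ')
    l⇒ (inj₁ l) = lA⇒ l
    l⇒ {v} (inj₂ l) = lC sp l
      where
      lC : IsSeq O ((P ++ Γ) ⊢ Δp) → v ∈LabC Δp → v ∈LabA (P ++ Γ')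
      lC (_ , _ , inj₂ (_ , ⊆PΓ)) l = lA⇒ (⊆PΓ v l)
      lC (_ , _ , inj₁ (e , _ , _ , only)) l with shared e
      ... | u , u∈Δp , u∈Δ rewrite only v l | sym (only u u∈Δp) = ∈LabA-++⁺ʳ P (lab⇒ E (inj₂ u∈Δ))
    l⇐ : ∀ {v} → v ∈LabA (P ++ Γ') → v ∈Lab ((P ++ Γ) ⊢ Δp)
    l⇐ l with ∈LabA-++⁻ P l
    ... | inj₁ j = inj₁ (∈LabA-++⁺ˡ j)
    ... | inj₂ j with lab⇐ E j
    ...   | inj₁ k = inj₁ (∈LabA-++⁺ʳ P k)
    ...   | inj₂ k = Δ⊆ _ k

  Embeds-premise : ∀ {Γ Γ' Δc x C Δ} A → Embeds Γ Γ' Δc → Δc ↭ (x , C) ∷ Δ → x ∈LabC A →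
    IsSeq O (Γ ⊢ (A ++ Δ)) → Embeds Γ Γ' (A ++ Δ)
  Embeds-premise A E p x∈A s = Embeds-++ˡ [] E s (∈LabC-lift A p (inj₂ (∈LabC-++⁺ˡ x∈A)))
    (λ _ → _ , ∈LabC-++⁺ˡ x∈A , ∈LabC-resp-↭ (↭-sym p) (here refl))

  PropL-embed : ∀ {Γ Γ' Δ x r y} → Embeds Γ Γ' Δ → PropL O Γ x r y → PropL O Γ' x r y
  PropL-embed E (S , S∈L , p) = S , S∈L , PPath-map (eq⇒ E) (rel⇒ E) p

  Fresh-embed : ∀ {Γ Γ' Δ y} → Embeds Γ Γ' Δ → Fresh y (Γ ⊢ Δ) → Fresh y (Γ' ⊢ Δ)
  Fresh-embed E f (inj₁ l) = f (lab⇐ E l)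
  Fresh-embed E f (inj₂ l) = f (inj₂ l)

  Der-embed : ∀ {h Γ Γ' Δ} → Embeds Γ Γ' Δ → Der O h (Γ ⊢ Δ) → Der O h (Γ' ⊢ Δ)
  Der-embed E (r-id s p) = r-id (IsSeq-embed E s) p
  Der-embed E (r-id≐ s n e) with neq⇒ E n
  ... | inj₁ n' = r-id≐ (IsSeq-embed E s) n' (≐*-map (eq⇒ E) e)
  ... | inj₂ n' = r-id≐ (IsSeq-embed E s) n' (≐*-sym (≐*-map (eq⇒ E) e))
  Der-embed E (r-s≐ {x = x} {y} {C} s p l e d) = r-s≐ (IsSeq-embed E s) p l (≐*-map (eq⇒ E) e)
    (Der-embed (Embeds-premise ((x , C) ∷ (y , C) ∷ []) E p (here refl) (Der⇒IsSeq d)) d)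
  Der-embed E (r-⊔ {x = x} {C} {D} s p d) = r-⊔ (IsSeq-embed E s) p
    (Der-embed (Embeds-premise ((x , C) ∷ (x , D) ∷ []) E p (here refl) (Der⇒IsSeq d)) d)
  Der-embed E (r-⊓ {x = x} {C} {D} s p d₁ d₂) = r-⊓ (IsSeq-embed E s) p
    (Der-embed (Embeds-premise ((x , C) ∷ []) E p (here refl) (Der⇒IsSeq d₁)) d₁)
    (Der-embed (Embeds-premise ((x , D) ∷ []) E p (here refl) (Der⇒IsSeq d₂)) d₂)
  Der-embed E (r-∃ {x = x} {y} {r} {C} s p pr d) = r-∃ (IsSeq-embed E s) p (PropL-embed E pr)
    (Der-embed (Embeds-premise ((x , ex r C) ∷ (y , C) ∷ []) E p (here refl) (Der⇒IsSeq d)) d)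
  Der-embed E (r-∀ {x = x} {y} {r} {C} s p f d) = r-∀ (IsSeq-embed E s) p (Fresh-embed E f)
    (Der-embed (Embeds-++ˡ (rel r x y ∷ []) E (Der⇒IsSeq d)
      (∈LabC-lift ((y , C) ∷ GCI O y) p (inj₁ (here occ-rel₁))) (λ ())) d)
  Der-embed {h = suc h} {Γ} {Γ'} E (r-≤ {Δ = Δ} {x} {r = r} {C} ys s p l u f d) =
    r-≤ ys (IsSeq-embed E s) p l u (All.map (Fresh-embed E) f)
      (reassoc Γ' (Der-embed (Embeds-++ˡ Q E (Der⇒IsSeq d')
         (∈LabC-lift (atmostSide O C ys) p (inj₁ x∈QΓ)) (λ e → ⊥-elim (∈LabA⇒≢[] x∈QΓ e))) d'))
    where
    Q = neqs ys ++ map (rel r x) ys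
    reassoc : ∀ G → Der O h ((Q ++ G) ⊢ (atmostSide O C ys ++ Δ)) →
      Der O h ((neqs ys ++ map (rel r x) ys ++ G) ⊢ (atmostSide O C ys ++ Δ))
    reassoc G = subst (λ G' → Der O h (G' ⊢ _)) (++-assoc (neqs ys) (map (rel r x) ys) G)
    d' = subst (λ G' → Der O h (G' ⊢ _)) (sym (++-assoc (neqs ys) (map (rel r x) ys) Γ)) d
    x∈QΓ : x ∈LabA (Q ++ Γ)
    x∈QΓ = subst (x ∈LabA_) (sym (++-assoc (neqs ys) (map (rel r x) ys) Γ)) (source∈atmostAnte ys l)
  Der-embed E (r-≥ {x = x} {n} {r} {C} ys s p pr d₁ d₂) =
    r-≥ ys (IsSeq-embed E s) p (λ i → PropL-embed E (pr i))
      (λ i → Der-embed (Embeds-premise ((lookup ys i , C) ∷ (x , atleast n r C) ∷ []) E p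
        (there (here refl)) (Der⇒IsSeq (d₁ i))) (d₁ i))
      (λ i j i<j → Der-embed (Embeds-++ˡ (eq (lookup ys i) (lookup ys j) ∷ []) E (Der⇒IsSeq (d₂ i j i<j))
        (∈LabC-lift ((x , atleast n r C) ∷ []) p (inj₂ (here refl))) (λ ())) (d₂ i j i<j))

  Embeds-∷ : ∀ {Γ Δ x} t → IsSeq O (Γ ⊢ Δ) → (∀ {r u v} → t ≢ rel r u v) → OccA x t →
    (∀ {v} → OccA v t → v ∈Lab (Γ ⊢ Δ)) → Embeds Γ (t ∷ Γ) Δ
  Embeds-∷ t s notRel x∈t t⊆ = record
    { rel⇒ = there
    ; rel⇐ = λ { (here e) → ⊥-elim (notRel (sym e)) ; (there i) → i }
    ; eq⇒ = λ i → fwd (there i) ◅ ε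
    ; neq⇒ = λ i → inj₁ (there i)
    ; lab⇒ = λ l → [ there , (λ { refl → here x∈t }) ] (IsSeq-∈Lab⇒∈LabA⊎≡ s (t⊆ x∈t) l)
    ; lab⇐ = λ { (here o) → t⊆ o ; (there l) → inj₁ l }
    }

  Embeds-neq-sym : ∀ {Γ Δ x y} → IsSeq O ((neq x y ∷ neq y x ∷ Γ) ⊢ Δ) →
    Embeds (neq x y ∷ neq y x ∷ Γ) (neq x y ∷ Γ) Δ
  Embeds-neq-sym {Γ} {Δ} {x} {y} s = record
    { rel⇒ = λ { (there (there i)) → there i }
    ; rel⇐ = λ { (there i) → there (there i) }
    ; eq⇒ = λ { (there (there i)) → fwd (there i) ◅ ε }
    ; neq⇒ = λ { (here refl) → inj₁ (here refl) ; (there (here refl)) → inj₂ (here refl)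
               ; (there (there i)) → inj₁ (there i) }
    ; lab⇒ = λ { (inj₁ l) → merge l ; (inj₂ l) → merge (IsSeq-∈LabC⇒∈LabA s (λ ()) l) }
    ; lab⇐ = λ { (here o) → inj₁ (here o) ; (there l) → inj₁ (there (there l)) }
    }
    where
    merge : ∀ {v} → v ∈LabA (neq x y ∷ neq y x ∷ Γ) → v ∈LabA (neq x y ∷ Γ)
    merge (here o) = here o
    merge (there (here occ-neq₁)) = here occ-neq₂
    merge (there (here occ-neq₂)) = here occ-neq₁
    merge (there (there l)) = there l

  Der-exchange : ∀ {h Γ Γ' Δ} → Γ ≢ [] → (∀ {a} → a ∈ Γ → a ∈ Γ') → (∀ {a} → a ∈ Γ' → a ∈ Γ) →
    Der O h (Γ ⊢ Δ) → Der O h (Γ' ⊢ Δ)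
  Der-exchange ne Γ⊆Γ' Γ'⊆Γ d = Der-embed E d
    where
    E : Embeds _ _ _
    E = record
      { rel⇒ = Γ⊆Γ' ; rel⇐ = Γ'⊆Γ ; eq⇒ = λ i → fwd (Γ⊆Γ' i) ◅ ε ; neq⇒ = λ i → inj₁ (Γ⊆Γ' i)
      ; lab⇒ = λ { (inj₁ l) → ∈LabA-mono Γ⊆Γ' l
                 ; (inj₂ l) → ∈LabA-mono Γ⊆Γ' (IsSeq-∈LabC⇒∈LabA (Der⇒IsSeq d) ne l) }
      ; lab⇐ = λ l → inj₁ (∈LabA-mono Γ'⊆Γ l) }

  Der-weaken : ∀ {h Γ Δ x C} → x ∈Lab (Γ ⊢ Δ) → WFC (rbox O) C →
    Der O h (Γ ⊢ Δ) → Der O h (Γ ⊢ ((x , C) ∷ Δ))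
  Der-weaken {x = x} {C} x∈ wf d = go d x∈
    where
    seq : ∀ {Γ Δ} → x ∈Lab (Γ ⊢ Δ) → IsSeq O (Γ ⊢ Δ) → IsSeq O (Γ ⊢ ((x , C) ∷ Δ))
    seq x∈ s = IsSeq-withSucc s (wf ∷ IsSeq⇒WFSucc s)
      (λ { v (here refl) → x∈ ; v (there l) → inj₂ l }) (λ _ → x , here refl)
    fresh : ∀ {Γ Δ y} → x ∈Lab (Γ ⊢ Δ) → Fresh y (Γ ⊢ Δ) → Fresh y (Γ ⊢ ((x , C) ∷ Δ))
    fresh x∈ f (inj₁ l) = f (inj₁ l)
    fresh x∈ f (inj₂ (here refl)) = f x∈
    fresh x∈ f (inj₂ (there l)) = f (inj₂ l)
    go : ∀ {h Γ Δ} → Der O h (Γ ⊢ Δ) → x ∈Lab (Γ ⊢ Δ) → Der O h (Γ ⊢ ((x , C) ∷ Δ))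
    premise : ∀ {h Γ Γ' Δc y D Δ} A → (∀ {v} → v ∈LabA Γ → v ∈LabA Γ') → Δc ↭ (y , D) ∷ Δ →
      y ∈Lab (Γ' ⊢ (A ++ Δ)) → x ∈Lab (Γ ⊢ Δc) → Der O h (Γ' ⊢ (A ++ Δ)) →
      Der O h (Γ' ⊢ (A ++ (x , C) ∷ Δ))
    premise A Γ⊆Γ' p y∈ x∈ d = Der-resp-↭ (go d (∈Lab-lift A Γ⊆Γ' p y∈ x∈)) (↭-++-push A _)
    go (r-id s p) x∈ = r-id (seq x∈ s) (↭-trans (↭-prep-swap p) (prep _ (↭-prep-swap ↭-refl)))
    go (r-id≐ s n e) x∈ = r-id≐ (seq x∈ s) n e
    go (r-s≐ {x = x'} {y} {C'} s p l e d) x∈ = r-s≐ (seq x∈ s) (↭-prep-swap p) l e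
      (premise ((x' , C') ∷ (y , C') ∷ []) id p (inj₂ (here refl)) x∈ d)
    go (r-⊔ {x = x'} {C'} {D} s p d) x∈ = r-⊔ (seq x∈ s) (↭-prep-swap p)
      (premise ((x' , C') ∷ (x' , D) ∷ []) id p (inj₂ (here refl)) x∈ d)
    go (r-⊓ {x = x'} {C'} {D} s p d₁ d₂) x∈ = r-⊓ (seq x∈ s) (↭-prep-swap p)
      (premise ((x' , C') ∷ []) id p (inj₂ (here refl)) x∈ d₁)
      (premise ((x' , D) ∷ []) id p (inj₂ (here refl)) x∈ d₂)
    go (r-∃ {x = x'} {y} {r} {C'} s p pr d) x∈ = r-∃ (seq x∈ s) (↭-prep-swap p) pr
      (premise ((x' , ex r C') ∷ (y , C') ∷ []) id p (inj₂ (here refl)) x∈ d)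
    go (r-∀ {y = y} {C = C'} s p f d) x∈ = r-∀ (seq x∈ s) (↭-prep-swap p) (fresh x∈ f)
      (premise ((y , C') ∷ GCI O y) there p (inj₁ (here occ-rel₁)) x∈ d)
    go (r-≤ {C = C'} ys s p l u f d) x∈ = r-≤ ys (seq x∈ s) (↭-prep-swap p) l u (All.map (fresh x∈) f)
      (premise (atmostSide O C' ys) (∈LabA-mono (Γ⊆atmostAnte ys)) p (inj₁ (source∈atmostAnte ys l)) x∈ d)
    go (r-≥ {x = x'} {n} {r} {C'} ys s p pr d₁ d₂) x∈ = r-≥ ys (seq x∈ s) (↭-prep-swap p) pr
      (λ i → premise ((lookup ys i , C') ∷ (x' , atleast n r C') ∷ []) id p (inj₂ (there (here refl))) x∈ (d₁ i))
      (λ i j i<j → premise ((x' , atleast n r C') ∷ []) there p (inj₂ (here refl)) x∈ (d₂ i j i<j))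

  OldOr≢ : Label → Seq → Label → Set
  OldOr≢ a S v = v ∈Lab S ⊎ v ≢ a

  Substitutable-premise : ∀ {a b Γ Δc Γp Δp} → (∀ {t} → t ∈ Γ → t ∈ Γp) →
    (∀ {v} → v ∈Lab (Γp ⊢ Δp) → OldOr≢ a (Γ ⊢ Δc) v) →
    Substitutable a b (Γ ⊢ Δc) → Substitutable a b (Γp ⊢ Δp)
  Substitutable-premise Γ⊆Γp old (inj₁ a∉) = inj₁ λ a∈ → [ a∉ , (λ a≢a → a≢a refl) ] (old a∈)
  Substitutable-premise Γ⊆Γp old (inj₂ (r , x , ra , rb)) = inj₂ (r , x , Γ⊆Γp ra , Γ⊆Γp rb)

  Substitutable-sameAnte : ∀ {a b Γ Δc x C Δ} A → Δc ↭ (x , C) ∷ Δ →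
    (∀ {v} → v ∈LabC A → v ∈Lab (Γ ⊢ Δc)) → Substitutable a b (Γ ⊢ Δc) → Substitutable a b (Γ ⊢ (A ++ Δ))
  Substitutable-sameAnte {a} {Γ = Γ} {Δc} A p A⊆ = Substitutable-premise id
    (∈Lab-premise-elim {OldOr≢ a (Γ ⊢ Δc)} A p (inj₁ ∘ inj₁) (inj₁ ∘ A⊆) (inj₁ ∘ inj₂))

  PropL-target∈Lab : ∀ {Γ Δc x C Δ r y} → Δc ↭ (x , C) ∷ Δ → PropL O Γ x r y → y ∈Lab (Γ ⊢ Δc)
  PropL-target∈Lab p (_ , _ , pa) with PPath-target pa
  ... | inj₁ refl = principal∈Lab p
  ... | inj₂ l = inj₁ l

  ≐*-target∈Lab : ∀ {Γ Δc x C Δ y} → Δc ↭ (x , C) ∷ Δ → x ≐*[ Γ ] y → y ∈Lab (Γ ⊢ Δc)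
  ≐*-target∈Lab p e with ≐*-target e
  ... | inj₁ refl = principal∈Lab p
  ... | inj₂ l = inj₁ l

  IsSeq-subst : ∀ {a b S} → IsSeq O S → Substitutable a b S → IsSeq O (mapSeq [ a / b ]ℓ S)
  IsSeq-subst {a} {b} {_ ⊢ _} s sa = IsSeq-image [ a / b ]ℓ {O} s (Substitutable⇒MergesOnlySiblings sa)

  Fresh-subst : ∀ {a b S y} → Fresh y S → y ≢ a → Fresh y (mapSeq [ a / b ]ℓ S)
  Fresh-subst {a} {b} f y≢a l with ∈Lab-preimage [ a / b ]ℓ l
  ... | u , u∈ , e with [/]ℓ-cases a b u
  ...   | inj₁ (_ , e₁) = y≢a (trans e e₁)
  ...   | inj₂ (_ , e₁) = f (subst (_∈Lab _) (sym (trans e e₁)) u∈)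

  -- b ∈Lab (Γ ⊢ Δ) only serves to keep the eigenlabels of the derivation distinct from b.
  Der-subst : ∀ h {Γ Δ} a b → b ∈Lab (Γ ⊢ Δ) → Substitutable a b (Γ ⊢ Δ) → Der O h (Γ ⊢ Δ) →
    Der O h (mapSeq [ a / b ]ℓ (Γ ⊢ Δ))

  Der-subst-sameAnte : ∀ h {Γ Δc x C Δ} a b A → b ∈Lab (Γ ⊢ Δc) → Substitutable a b (Γ ⊢ Δc) →
    Δc ↭ (x , C) ∷ Δ → x ∈LabC A → (∀ {v} → v ∈LabC A → v ∈Lab (Γ ⊢ Δc)) →
    Der O h (Γ ⊢ (A ++ Δ)) → Der O h (mapSeq [ a / b ]ℓ (Γ ⊢ (A ++ Δ)))
  Der-subst-sameAnte h a b A b∈ sa p x∈A A⊆ =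
    Der-subst h a b (∈Lab-lift A id p (inj₂ (∈LabC-++⁺ˡ x∈A)) b∈) (Substitutable-sameAnte A p A⊆ sa)

  Der-subst-∀ : ∀ h {Γ Δc Δ x y r C} a b → b ∈Lab (Γ ⊢ Δc) → Substitutable a b (Γ ⊢ Δc) →
    IsSeq O (Γ ⊢ Δc) → Δc ↭ (x , all r C) ∷ Δ → Fresh y (Γ ⊢ Δc) → y ≢ a →
    Der O h (AllPremise O r x y C Γ Δ) → Der O (suc h) (mapSeq [ a / b ]ℓ (Γ ⊢ Δc))
  Der-subst-∀ h {Γ} {Δc} {Δ} {x} {y} {r} {C} a b b∈ sa s p f y≢a d =
    r-∀ (IsSeq-subst s sa) (PP.map⁺ (mapLC σ) p) (Fresh-subst f y≢a)
      (subst (λ z → Der O h (AllPremise O r (σ x) z C (mapAnte σ Γ) (mapSucc σ Δ))) ([/]ℓ-miss y≢b)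
        (subst (Der O h) (mapSeq-AllPremise σ O r x y C Γ Δ) (Der-subst h a b b∈' sa' d)))
    where
    σ = [ a / b ]ℓ
    y≢b : y ≢ b
    y≢b refl = f b∈
    b∈' = ∈Lab-lift ((y , C) ∷ GCI O y) there p (inj₁ (here occ-rel₁)) b∈
    oldΓ : ∀ {v} → v ∈LabA (rel r x y ∷ Γ) → OldOr≢ a (Γ ⊢ Δc) v
    oldΓ (here occ-rel₁) = inj₁ (principal∈Lab p)
    oldΓ (here occ-rel₂) = inj₂ y≢a
    oldΓ (there l) = inj₁ (inj₁ l)
    oldA : ∀ {v} → v ∈LabC ((y , C) ∷ GCI O y) → OldOr≢ a (Γ ⊢ Δc) v
    oldA (here refl) = inj₂ y≢a
    oldA (there l) rewrite ∈LabC-GCI⁻ {O} l = inj₂ y≢a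
    sa' = Substitutable-premise there (∈Lab-premise-elim ((y , C) ∷ GCI O y) p oldΓ oldA (inj₁ ∘ inj₂)) sa

  Der-subst-≤ : ∀ h {Γ Δc Δ x n r C} a b → b ∈Lab (Γ ⊢ Δc) → Substitutable a b (Γ ⊢ Δc) →
    IsSeq O (Γ ⊢ Δc) → Δc ↭ (x , atmost n r C) ∷ Δ → ∀ ys → length ys ≡ suc n → Unique ys →
    All (λ y → Fresh y (Γ ⊢ Δc)) ys → a ∉ ys →
    Der O h (AtmostPremise O r x C ys Γ Δ) → Der O (suc h) (mapSeq [ a / b ]ℓ (Γ ⊢ Δc))
  Der-subst-≤ h {Γ} {Δc} {Δ} {x} {n} {r} {C} a b b∈ sa s p ys l u fs a∉ys d =
    r-≤ ys (IsSeq-subst s sa) (PP.map⁺ (mapLC σ) p) l u 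
      (All.tabulate (λ y∈ → Fresh-subst (All.lookup fs y∈) λ { refl → a∉ys y∈ }))
      (subst (λ zs → Der O h (AtmostPremise O r (σ x) C zs (mapAnte σ Γ) (mapSucc σ Δ))) σys≡ys
        (subst (Der O h) (mapSeq-AtmostPremise σ O r x C ys Γ Δ) (Der-subst h a b b∈' sa' d)))
    where
    σ = [ a / b ]ℓ
    σys≡ys : map σ ys ≡ ys
    σys≡ys = map-id-local (All.map (λ f → [/]ℓ-miss λ { refl → f b∈ }) fs)
    b∈' = ∈Lab-lift (atmostSide O C ys) (∈LabA-mono (Γ⊆atmostAnte ys)) p (inj₁ (source∈atmostAnte ys l)) b∈
    ys-old : ∀ {v} → v ∈ ys → OldOr≢ a (Γ ⊢ Δc) v
    ys-old v∈ys = inj₂ λ { refl → a∉ys v∈ys }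
    oldΓ : ∀ {v} → v ∈LabA (neqs ys ++ map (rel r x) ys ++ Γ) → OldOr≢ a (Γ ⊢ Δc) v
    oldΓ l with ∈LabA-++⁻ (neqs ys) l
    ... | inj₁ l₁ = ys-old (∈LabA-neqs⁻ ys l₁)
    ... | inj₂ l₂ with ∈LabA-++⁻ (map (rel r x) ys) l₂
    ...   | inj₂ l₃ = inj₁ (inj₁ l₃)
    ...   | inj₁ l₃ with ∈LabA-rels⁻ ys l₃
    ...     | inj₁ refl = inj₁ (principal∈Lab p)
    ...     | inj₂ v∈ys = ys-old v∈ys
    sa' = Substitutable-premise (Γ⊆atmostAnte ys)
      (∈Lab-premise-elim (atmostSide O C ys) p oldΓ (ys-old ∘ ∈LabC-atmostSide⁻ {O} {C} ys) (inj₁ ∘ inj₂)) sa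

  Der-subst-≥ : ∀ h {Γ Δc Δ x n r C} a b → b ∈Lab (Γ ⊢ Δc) → Substitutable a b (Γ ⊢ Δc) →
    IsSeq O (Γ ⊢ Δc) → Δc ↭ (x , atleast n r C) ∷ Δ → (ys : Vec Label n) →
    (∀ i → PropL O Γ x r (lookup ys i)) →
    (∀ i → Der O h (Γ ⊢ ((lookup ys i , C) ∷ (x , atleast n r C) ∷ Δ))) →
    (∀ i j → i <ᶠ j → Der O h ((eq (lookup ys i) (lookup ys j) ∷ Γ) ⊢ ((x , atleast n r C) ∷ Δ))) →
    Der O (suc h) (mapSeq [ a / b ]ℓ (Γ ⊢ Δc))
  Der-subst-≥ h {Γ} {Δc} {Δ} {x} {n} {r} {C} a b b∈ sa s p ys pr d₁ d₂ =
    r-≥ (Vec.map σ ys) (IsSeq-subst s sa) (PP.map⁺ (mapLC σ) p)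
      (λ i → subst (PropL O (mapAnte σ Γ) (σ x) r) (sym (σys i)) (PropL-image σ (pr i)))
      (λ i → subst (λ z → Der O h (mapAnte σ Γ ⊢ ((z , C) ∷ (σ x , atleast n r C) ∷ mapSucc σ Δ)))
        (sym (σys i))
        (Der-subst-sameAnte h a b ((lookup ys i , C) ∷ (x , atleast n r C) ∷ []) b∈ sa p (there (here refl))
          (λ { (here refl) → PropL-target∈Lab p (pr i) ; (there (here refl)) → principal∈Lab p }) (d₁ i)))
      (λ i j i<j → subst₂ (λ z z' → Der O h ((eq z z' ∷ mapAnte σ Γ) ⊢ ((σ x , atleast n r C) ∷ mapSucc σ Δ)))
        (sym (σys i)) (sym (σys j))
        (Der-subst h a b (∈Lab-lift ((x , atleast n r C) ∷ []) there p (inj₂ (here refl)) b∈)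
          (Substitutable-premise there (∈Lab-premise-elim ((x , atleast n r C) ∷ []) p (old i j)
            (λ { (here refl) → inj₁ (principal∈Lab p) }) (inj₁ ∘ inj₂)) sa)
          (d₂ i j i<j)))
    where
    σ = [ a / b ]ℓ
    σys : ∀ i → lookup (Vec.map σ ys) i ≡ σ (lookup ys i)
    σys i = VecP.lookup-map i σ ys
    old : ∀ i j {v} → v ∈LabA (eq (lookup ys i) (lookup ys j) ∷ Γ) → OldOr≢ a (Γ ⊢ Δc) v
    old i j (here occ-eq₁) = inj₁ (PropL-target∈Lab p (pr i))
    old i j (here occ-eq₂) = inj₁ (PropL-target∈Lab p (pr j))
    old i j (there l) = inj₁ (inj₁ l)

  fixes-conclusion : ∀ {w a x D Γ Δc Δ} → Δc ↭ (x , D) ∷ Δ → Fresh a (Γ ⊢ Δc) →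
    [ w / a ]ℓ x ≡ x × mapAnte [ w / a ]ℓ Γ ≡ Γ × mapSucc [ w / a ]ℓ Δ ≡ Δ
  fixes-conclusion p a-fresh =
    fixed (principal∈Lab p) , mapAnte-id _ (fixed ∘ inj₁) ,
    mapSucc-id _ (fixed ∘ inj₂ ∘ ∈LabC-resp-↭ (↭-sym p) ∘ there)
    where
    fixed : ∀ {u} → u ∈Lab _ → [ _ / _ ]ℓ u ≡ u
    fixed u∈ = [/]ℓ-miss λ { refl → a-fresh u∈ }

  AllPremise-rename : ∀ {r x a C Γ Δc D Δ} w → Δc ↭ (x , D) ∷ Δ → Fresh a (Γ ⊢ Δc) →
    mapSeq [ w / a ]ℓ (AllPremise O r x a C Γ Δ) ≡ AllPremise O r x w C Γ Δ
  AllPremise-rename {r} {x} {a} {C} {Γ} {Δ = Δ} w p a-fresh with fixes-conclusion {w} p a-fresh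
  ... | x-fixed , Γ-fixed , Δ-fixed =
    trans (mapSeq-AllPremise [ w / a ]ℓ O r x a C Γ Δ)
      (cong₂ (λ { (u , v) (Γ' , Δ') → AllPremise O r u v C Γ' Δ' })
        (cong₂ _,_ x-fixed ([/]ℓ-hit w a)) (cong₂ _,_ Γ-fixed Δ-fixed))

  AtmostPremise-rename : ∀ {x a Γ Δc D Δ} r C ys w → Δc ↭ (x , D) ∷ Δ → Fresh a (Γ ⊢ Δc) →
    mapSeq [ w / a ]ℓ (AtmostPremise O r x C ys Γ Δ) ≡ AtmostPremise O r x C (map [ w / a ]ℓ ys) Γ Δ
  AtmostPremise-rename {x} {a} {Γ} {Δ = Δ} r C ys w p a-fresh with fixes-conclusion {w} p a-fresh
  ... | x-fixed , Γ-fixed , Δ-fixed =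
    trans (mapSeq-AtmostPremise [ w / a ]ℓ O r x C ys Γ Δ)
      (cong₂ (λ { u (Γ' , Δ') → AtmostPremise O r u C (map [ w / a ]ℓ ys) Γ' Δ' })
        x-fixed (cong₂ _,_ Γ-fixed Δ-fixed))

  -- The eigenlabel of the premise is a itself: rename it to a label w fresh for the premise first.
  Der-subst-∀-eigen : ∀ h {Γ Δc Δ x r C} a b → b ∈Lab (Γ ⊢ Δc) → Substitutable a b (Γ ⊢ Δc) →
    IsSeq O (Γ ⊢ Δc) → Δc ↭ (x , all r C) ∷ Δ → Fresh a (Γ ⊢ Δc) →
    Der O h (AllPremise O r x a C Γ Δ) → Der O (suc h) (mapSeq [ a / b ]ℓ (Γ ⊢ Δc))
  Der-subst-∀-eigen h {Γ} {Δc} {Δ} {x} {r} {C} a b b∈ sa s p a-fresh d =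
    Der-subst-∀ h a b b∈ sa s p w-fresh w≢a
      (subst (Der O h) (AllPremise-rename w p a-fresh)
        (Der-subst h w a (inj₁ (here occ-rel₂)) (inj₁ w-fresh′) d))
    where
    w : Label
    w = proj₁ (fresh-label (AllPremise O r x a C Γ Δ))
    w-fresh′ : Fresh w (AllPremise O r x a C Γ Δ)
    w-fresh′ = proj₂ (fresh-label (AllPremise O r x a C Γ Δ))
    w≢a : w ≢ a
    w≢a e = w-fresh′ (subst (_∈Lab AllPremise O r x a C Γ Δ) (sym e) (inj₁ (here occ-rel₂)))
    w-fresh : Fresh w (Γ ⊢ Δc)
    w-fresh l = w-fresh′ (∈Lab-lift ((a , C) ∷ GCI O a) there p (inj₁ (here occ-rel₁)) l)

  Der-subst-≤-eigen : ∀ h {Γ Δc Δ x n r C} a b → b ∈Lab (Γ ⊢ Δc) → Substitutable a b (Γ ⊢ Δc) →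
    IsSeq O (Γ ⊢ Δc) → Δc ↭ (x , atmost n r C) ∷ Δ → ∀ ys → length ys ≡ suc n → Unique ys →
    All (λ y → Fresh y (Γ ⊢ Δc)) ys → a ∈ ys →
    Der O h (AtmostPremise O r x C ys Γ Δ) → Der O (suc h) (mapSeq [ a / b ]ℓ (Γ ⊢ Δc))
  Der-subst-≤-eigen h {Γ} {Δc} {Δ} {x} {n} {r} {C} a b b∈ sa s p ys l u fs a∈ys d =
    Der-subst-≤ h a b b∈ sa s p (map σ ys) (trans (length-map σ ys) l)
      (Unique-map-[/]ℓ ys u (w-fresh′ ∘ ys⊆)) (AllP.map⁺ (All.map fresh-image fs)) a∉σys
      (subst (Der O h) (AtmostPremise-rename r C ys w p (All.lookup fs a∈ys))
        (Der-subst h w a (ys⊆ a∈ys) (inj₁ w-fresh′) d))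
    where
    w : Label
    w = proj₁ (fresh-label (AtmostPremise O r x C ys Γ Δ))
    w-fresh′ : Fresh w (AtmostPremise O r x C ys Γ Δ)
    w-fresh′ = proj₂ (fresh-label (AtmostPremise O r x C ys Γ Δ))
    σ = [ w / a ]ℓ
    ys⊆ : ∀ {y} → y ∈ ys → y ∈Lab AtmostPremise O r x C ys Γ Δ
    ys⊆ y∈ = inj₂ (∈LabC-++⁺ˡ (∈LabC-atmostSide⁺ {O} {C} ys y∈))
    w-fresh : Fresh w (Γ ⊢ Δc)
    w-fresh v∈ = w-fresh′
      (∈Lab-lift (atmostSide O C ys) (∈LabA-mono (Γ⊆atmostAnte ys)) p (inj₁ (source∈atmostAnte ys l)) v∈)
    fresh-image : ∀ {y} → Fresh y (Γ ⊢ Δc) → Fresh (σ y) (Γ ⊢ Δc)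
    fresh-image {y} f with [/]ℓ-cases w a y
    ... | inj₁ (_ , e) = subst (λ z → Fresh z (Γ ⊢ Δc)) (sym e) w-fresh
    ... | inj₂ (_ , e) = subst (λ z → Fresh z (Γ ⊢ Δc)) (sym e) f
    a∉σys : a ∉ map σ ys
    a∉σys a∈ with ∈-map⁻ σ a∈
    ... | y , y∈ , e with [/]ℓ-cases w a y
    ...   | inj₁ (_ , e₁) = w-fresh′ (subst (_∈Lab AtmostPremise O r x C ys Γ Δ) (trans e e₁) (ys⊆ a∈ys))
    ...   | inj₂ (y≢a , e₁) = y≢a (sym (trans e e₁))

  Der-subst zero a b b∈ sa ()
  Der-subst (suc h) a b b∈ sa (r-id s p) = r-id (IsSeq-subst s sa) (PP.map⁺ (mapLC [ a / b ]ℓ) p)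
  Der-subst (suc h) a b b∈ sa (r-id≐ s n e) =
    r-id≐ (IsSeq-subst s sa) (∈-map⁺ (mapAtom [ a / b ]ℓ) n) (≐*-image [ a / b ]ℓ e)
  Der-subst (suc h) a b b∈ sa (r-s≐ {x = x} {y} {C} s p l e d) =
    r-s≐ (IsSeq-subst s sa) (PP.map⁺ (mapLC [ a / b ]ℓ) p) l (≐*-image [ a / b ]ℓ e)
      (Der-subst-sameAnte h a b ((x , C) ∷ (y , C) ∷ []) b∈ sa p (here refl)
        (λ { (here refl) → principal∈Lab p ; (there (here refl)) → ≐*-target∈Lab p e }) d)
  Der-subst (suc h) a b b∈ sa (r-⊔ {x = x} {C} {D} s p d) =
    r-⊔ (IsSeq-subst s sa) (PP.map⁺ (mapLC [ a / b ]ℓ) p)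
      (Der-subst-sameAnte h a b ((x , C) ∷ (x , D) ∷ []) b∈ sa p (here refl)
        (λ { (here refl) → principal∈Lab p ; (there (here refl)) → principal∈Lab p }) d)
  Der-subst (suc h) a b b∈ sa (r-⊓ {x = x} {C} {D} s p d₁ d₂) =
    r-⊓ (IsSeq-subst s sa) (PP.map⁺ (mapLC [ a / b ]ℓ) p)
      (Der-subst-sameAnte h a b ((x , C) ∷ []) b∈ sa p (here refl) (λ { (here refl) → principal∈Lab p }) d₁)
      (Der-subst-sameAnte h a b ((x , D) ∷ []) b∈ sa p (here refl) (λ { (here refl) → principal∈Lab p }) d₂)
  Der-subst (suc h) a b b∈ sa (r-∃ {x = x} {y} {r} {C} s p pr d) =
    r-∃ (IsSeq-subst s sa) (PP.map⁺ (mapLC [ a / b ]ℓ) p) (PropL-image [ a / b ]ℓ pr)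
      (Der-subst-sameAnte h a b ((x , ex r C) ∷ (y , C) ∷ []) b∈ sa p (here refl)
        (λ { (here refl) → principal∈Lab p ; (there (here refl)) → PropL-target∈Lab p pr }) d)
  Der-subst (suc h) a b b∈ sa (r-∀ {y = y} s p f d) with y ≟ a
  ... | no y≢a = Der-subst-∀ h a b b∈ sa s p f y≢a d
  ... | yes refl = Der-subst-∀-eigen h a b b∈ sa s p f d
  Der-subst (suc h) a b b∈ sa (r-≤ ys s p l u f d) with a ∈? ys
  ... | no a∉ys = Der-subst-≤ h a b b∈ sa s p ys l u f a∉ys d
  ... | yes a∈ys = Der-subst-≤-eigen h a b b∈ sa s p ys l u f a∈ys d
  Der-subst (suc h) a b b∈ sa (r-≥ ys s p pr d₁ d₂) = Der-subst-≥ h a b b∈ sa s p ys pr d₁ d₂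

  -- Height-preserving inversion of the principal formula t into T, for every rule that does not
  -- keep its principal formula in the premises (so not for ∃ and ≥); Keep is an invariant of the
  -- antecedent that holds along a branch and makes the labels of T available.
  module _ (t : LConcept) (T : List LConcept) (wfT : WFSucc T) (T-label : Σ Label λ v → v ∈LabC T)
    (Keep : List SAtom → Set) (Keep-mono : ∀ {Γ Γ'} → (∀ {a} → a ∈ Γ → a ∈ Γ') → Keep Γ → Keep Γ')
    (T⊆ : ∀ {Γ v} → Keep Γ → v ∈LabC T → v ≡ proj₁ t ⊎ v ∈LabA Γ)
    (not-literal : ∀ {x A} → t ≢ (x , at A) × t ≢ (x , nat A))
    (not-kept : ∀ {x r n C} → t ≢ (x , ex r C) × t ≢ (x , atleast n r C))
    (on⊔ : ∀ {h Γ Δ₀ Δ x C D} → (x , C ⊔ D) ≡ t → Keep Γ → Δ₀ ↭ Δ →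
      Der O h (Γ ⊢ ((x , C) ∷ (x , D) ∷ Δ₀)) → Der O (suc h) (Γ ⊢ (T ++ Δ)))
    (on⊓ : ∀ {h Γ Δ₀ Δ x C D} → (x , C ⊓ D) ≡ t → Keep Γ → Δ₀ ↭ Δ →
      Der O h (Γ ⊢ ((x , C) ∷ Δ₀)) → Der O h (Γ ⊢ ((x , D) ∷ Δ₀)) → Der O (suc h) (Γ ⊢ (T ++ Δ)))
    (on∀ : ∀ {h Γ Δc Δ₀ Δ x y r C} → (x , all r C) ≡ t → Keep Γ → Δ₀ ↭ Δ →
      Δc ↭ (x , all r C) ∷ Δ₀ → Fresh y (Γ ⊢ Δc) →
      Der O h (AllPremise O r x y C Γ Δ₀) → Der O (suc h) (Γ ⊢ (T ++ Δ)))
    (on≤ : ∀ {h Γ Δc Δ₀ Δ x n r C} → (x , atmost n r C) ≡ t → Keep Γ → Δ₀ ↭ Δ →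
      Δc ↭ (x , atmost n r C) ∷ Δ₀ → ∀ ys → length ys ≡ suc n → Unique ys →
      All (λ y → Fresh y (Γ ⊢ Δc)) ys →
      Der O h (AtmostPremise O r x C ys Γ Δ₀) → Der O (suc h) (Γ ⊢ (T ++ Δ)))
    where

    private
      seq : ∀ {Γ Δc Δ} → Keep Γ → IsSeq O (Γ ⊢ Δc) → Δc ↭ t ∷ Δ → IsSeq O (Γ ⊢ (T ++ Δ))
      seq k s π = IsSeq-withSucc s (AllP.++⁺ wfT (drop-t (PP.All-resp-↭ π (IsSeq⇒WFSucc s)))) labels
        (λ _ → proj₁ T-label , ∈LabC-++⁺ˡ (proj₂ T-label))
        where
        drop-t : ∀ {Δ} → WFSucc (t ∷ Δ) → WFSucc Δ
        drop-t (_ ∷ wf) = wf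
        labels : ∀ v → v ∈LabC (T ++ _) → v ∈Lab (_ ⊢ _)
        labels v l with ∈LabC-++⁻ T l
        ... | inj₂ l' = inj₂ (∈LabC-resp-↭ (↭-sym π) (there l'))
        ... | inj₁ l' with T⊆ k l'
        ...   | inj₁ refl = inj₂ (∈LabC-resp-↭ (↭-sym π) (here refl))
        ...   | inj₂ l″ = inj₁ l″

      fresh : ∀ {Γ Δc Δ y} → Keep Γ → Δc ↭ t ∷ Δ → Fresh y (Γ ⊢ Δc) → Fresh y (Γ ⊢ (T ++ Δ))
      fresh k π f (inj₁ l) = f (inj₁ l)
      fresh k π f (inj₂ l) with ∈LabC-++⁻ T l
      ... | inj₂ l' = f (inj₂ (∈LabC-resp-↭ (↭-sym π) (there l')))
      ... | inj₁ l' with T⊆ k l'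
      ...   | inj₁ refl = f (inj₂ (∈LabC-resp-↭ (↭-sym π) (here refl)))
      ...   | inj₂ l″ = f (inj₁ l″)

    Der-invert : ∀ {h Γ Δc Δ} → Keep Γ → Der O h (Γ ⊢ Δc) → Δc ↭ t ∷ Δ → Der O h (Γ ⊢ (T ++ Δ))

    private
      side : ∀ {h Γ Δ R} A → Keep Γ → Der O h (Γ ⊢ (A ++ Δ)) → Δ ↭ t ∷ R → Der O h (Γ ⊢ (A ++ T ++ R))
      side A k d q = Der-resp-↭ (Der-invert k d (↭-++-pull A q)) (PP.shifts T A)

    Der-invert k (r-id s p) π with PP.∈-resp-↭ (↭-trans (↭-sym p) π) (here refl)
                                | PP.∈-resp-↭ (↭-trans (↭-sym p) π) (there (here refl))
    ... | here e | _ = ⊥-elim (proj₁ not-literal (sym e))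
    ... | _ | here e = ⊥-elim (proj₂ not-literal (sym e))
    ... | there i₁ | there i₂ with ∈⇒↭∷∷ (∈-++⁺ʳ T i₁) (∈-++⁺ʳ T i₂) (λ ())
    ...   | _ , q = r-id (seq k s π) q
    Der-invert k (r-id≐ s n e) π = r-id≐ (seq k s π) n e
    Der-invert k (r-s≐ {x = x} {y} {C} s p l e d) π with ∷↭∷-inv (↭-trans (↭-sym p) π)
    ... | inj₁ (refl , _) = ⊥-elim (literal l)
      where
      literal : Literal _ → ⊥
      literal lit-pos = proj₁ not-literal refl
      literal lit-neg = proj₂ not-literal refl
    ... | inj₂ (_ , q , q') = r-s≐ (seq k s π) (↭-++-pull T q') l e (side ((x , C) ∷ (y , C) ∷ []) k d q)
    Der-invert k (r-⊔ {x = x} {C} {D} s p d) π with ∷↭∷-inv (↭-trans (↭-sym p) π)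
    ... | inj₁ (e , q) = on⊔ (sym e) k q d
    ... | inj₂ (_ , q , q') = r-⊔ (seq k s π) (↭-++-pull T q') (side ((x , C) ∷ (x , D) ∷ []) k d q)
    Der-invert k (r-⊓ {x = x} {C} {D} s p d₁ d₂) π with ∷↭∷-inv (↭-trans (↭-sym p) π)
    ... | inj₁ (e , q) = on⊓ (sym e) k q d₁ d₂
    ... | inj₂ (_ , q , q') = r-⊓ (seq k s π) (↭-++-pull T q')
      (side ((x , C) ∷ []) k d₁ q) (side ((x , D) ∷ []) k d₂ q)
    Der-invert k (r-∃ {x = x} {y} {r} {C} s p pr d) π with ∷↭∷-inv (↭-trans (↭-sym p) π)
    ... | inj₁ (refl , _) = ⊥-elim (proj₁ (not-kept {n = 0}) refl)
    ... | inj₂ (_ , q , q') = r-∃ (seq k s π) (↭-++-pull T q') pr (side ((x , ex r C) ∷ (y , C) ∷ []) k d q)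
    Der-invert k (r-∀ {y = y} {C = C} s p f d) π with ∷↭∷-inv (↭-trans (↭-sym p) π)
    ... | inj₁ (e , q) = on∀ (sym e) k q p f d
    ... | inj₂ (_ , q , q') = r-∀ (seq k s π) (↭-++-pull T q') (fresh k π f)
      (side ((y , C) ∷ GCI O y) (Keep-mono there k) d q)
    Der-invert k (r-≤ {x = x} {r = r} {C} ys s p l u f d) π with ∷↭∷-inv (↭-trans (↭-sym p) π)
    ... | inj₁ (e , q) = on≤ (sym e) k q p ys l u f d
    ... | inj₂ (_ , q , q') = r-≤ ys (seq k s π) (↭-++-pull T q') l u (All.map (fresh k π) f)
      (side (atmostSide O C ys) (Keep-mono (Γ⊆atmostAnte ys) k) d q)
    Der-invert k (r-≥ {x = x} {n} {r} {C} ys s p pr d₁ d₂) π with ∷↭∷-inv (↭-trans (↭-sym p) π)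
    ... | inj₁ (refl , _) = ⊥-elim (proj₂ not-kept refl)
    ... | inj₂ (_ , q , q') = r-≥ ys (seq k s π) (↭-++-pull T q') pr
      (λ i → side ((lookup ys i , C) ∷ (x , atleast n r C) ∷ []) k (d₁ i) q)
      (λ i j i<j → side ((x , atleast n r C) ∷ []) (Keep-mono there k) (d₂ i j i<j) q)

  -- The fresh successors of a ≤-premise can be identified, one by one, with existing
  -- r-successors of x: each step substitutes a sibling for a sibling.
  Der-≤-merge : ∀ {h Γ Δc Δ x r D C} → Δc ↭ (x , D) ∷ Δ → ∀ pre zs ys →
    length zs ≡ length ys → Unique zs → All (λ z → Fresh z (Γ ⊢ Δc)) zs →
    All (_∉ pre) zs → All (λ y → rel r x y ∈ Γ) ys →
    Der O h (AtmostPremise O r x C (pre ++ zs) Γ Δ) → Der O h (AtmostPremise O r x C (pre ++ ys) Γ Δ)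
  Der-≤-merge p pre [] [] _ _ _ _ _ d = d
  Der-≤-merge {h} {Γ} {Δc} {Δ} {x} {r} {C = C} p pre (z ∷ zs) (y ∷ ys) l
    (z∉zs AllPairs.∷ u) (fz ∷ fs) (z∉pre ∷ zs∉pre) (ry ∷ rys) d =
    ≡-premise (++-assoc pre (y ∷ []) ys)
      (Der-≤-merge p (pre ++ y ∷ []) zs ys (suc-injective l) u fs (All.zipWith ∉pre∷ʳy (fs , zs∉pre)) rys
        (≡-premise (sym (++-assoc pre (y ∷ []) zs))
          (≡-premise renamed (subst (Der O h) (AtmostPremise-rename r C us y p fz) d₁))))
    where
    us = pre ++ z ∷ zs
    ≡-premise : ∀ {vs ws} → vs ≡ ws →
      Der O h (AtmostPremise O r x C vs Γ Δ) → Der O h (AtmostPremise O r x C ws Γ Δ)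
    ≡-premise e = subst (λ vs → Der O h (AtmostPremise O r x C vs Γ Δ)) e
    ∉pre∷ʳy : ∀ {z'} → Fresh z' (Γ ⊢ Δc) × z' ∉ pre → z' ∉ pre ++ y ∷ []
    ∉pre∷ʳy (fz' , z'∉pre) i with ∈-++⁻ pre i
    ... | inj₁ j = z'∉pre j
    ... | inj₂ (here refl) = fz' (inj₁ (lose ry occ-rel₂))
    z∈us : z ∈ us
    z∈us = ∈-++⁺ʳ pre (here refl)
    d₁ = Der-subst h y z (inj₂ (∈LabC-++⁺ˡ (∈LabC-atmostSide⁺ {O} {C} us z∈us)))
      (inj₂ (r , x , Γ⊆atmostAnte us ry , rel∈atmostAnte us z∈us)) d
    renamed : map [ y / z ]ℓ us ≡ pre ++ y ∷ zs
    renamed = trans (map-++ [ y / z ]ℓ pre (z ∷ zs))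
      (cong₂ _++_ (map-id-local (All.tabulate λ i → [/]ℓ-miss λ { refl → z∉pre i }))
        (cong₂ _∷_ ([/]ℓ-hit y z) (map-id-local (All.map (λ z≢ → [/]ℓ-miss (z≢ ∘ sym)) z∉zs))))

  module _ (wfTBox : All (WFC (rbox O)) (tbox O)) where

    WF-GCI : ∀ y → WFSucc (GCI O y)
    WF-GCI y = AllP.map⁺ (All.map WFC-¬̇ wfTBox)

    WF-atmostSide : ∀ {C} ys → WFC (rbox O) C → WFSucc (atmostSide O C ys)
    WF-atmostSide [] wf = []
    WF-atmostSide (y ∷ ys) wf = AllP.++⁺ (WFC-¬̇ wf ∷ WF-GCI y) (WF-atmostSide ys wf)

    Der⇒WFC-principal : ∀ {h Γ Δc Δ t} → Der O h (Γ ⊢ Δc) → Δc ↭ t ∷ Δ → WFC (rbox O) (proj₂ t)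
    Der⇒WFC-principal d π = All.lookup (PP.All-resp-↭ π (IsSeq⇒WFSucc (Der⇒IsSeq d))) (here refl)

    Der-⊔-inv : ∀ {h Γ Δc Δ x C D} → Der O h (Γ ⊢ Δc) → Δc ↭ (x , C ⊔ D) ∷ Δ →
      Der O h (Γ ⊢ ((x , C) ∷ (x , D) ∷ Δ))
    Der-⊔-inv {x = x} {C} {D} d π with Der⇒WFC-principal d π
    ... | wf-⊔ wfC wfD = Der-invert (x , C ⊔ D) ((x , C) ∷ (x , D) ∷ []) (wfC ∷ wfD ∷ []) (x , here refl)
      (λ _ → ⊤) _ (λ { _ (here refl) → inj₁ refl ; _ (there (here refl)) → inj₁ refl })
      ((λ ()) , (λ ())) ((λ ()) , (λ ())) on⊔ (λ ()) (λ ()) (λ ()) tt d π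
      where
      on⊔ : ∀ {h Γ Δ₀ Δ x' C' D'} → (x' , C' ⊔ D') ≡ (x , C ⊔ D) → ⊤ → Δ₀ ↭ Δ →
        Der O h (Γ ⊢ ((x' , C') ∷ (x' , D') ∷ Δ₀)) → Der O (suc h) (Γ ⊢ ((x , C) ∷ (x , D) ∷ Δ))
      on⊔ refl _ q d = Der-lift (Der-resp-↭ d (prep _ (prep _ q)))

    Der-⊓-invˡ : ∀ {h Γ Δc Δ x C D} → Der O h (Γ ⊢ Δc) → Δc ↭ (x , C ⊓ D) ∷ Δ → Der O h (Γ ⊢ ((x , C) ∷ Δ))
    Der-⊓-invˡ {x = x} {C} {D} d π with Der⇒WFC-principal d π
    ... | wf-⊓ wfC _ = Der-invert (x , C ⊓ D) ((x , C) ∷ []) (wfC ∷ []) (x , here refl)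
      (λ _ → ⊤) _ (λ { _ (here refl) → inj₁ refl }) ((λ ()) , (λ ())) ((λ ()) , (λ ()))
      (λ ()) on⊓ (λ ()) (λ ()) tt d π
      where
      on⊓ : ∀ {h Γ Δ₀ Δ x' C' D'} → (x' , C' ⊓ D') ≡ (x , C ⊓ D) → ⊤ → Δ₀ ↭ Δ →
        Der O h (Γ ⊢ ((x' , C') ∷ Δ₀)) → Der O h (Γ ⊢ ((x' , D') ∷ Δ₀)) → Der O (suc h) (Γ ⊢ ((x , C) ∷ Δ))
      on⊓ refl _ q d₁ _ = Der-lift (Der-resp-↭ d₁ (prep _ q))

    Der-⊓-invʳ : ∀ {h Γ Δc Δ x C D} → Der O h (Γ ⊢ Δc) → Δc ↭ (x , C ⊓ D) ∷ Δ → Der O h (Γ ⊢ ((x , D) ∷ Δ))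
    Der-⊓-invʳ {x = x} {C} {D} d π with Der⇒WFC-principal d π
    ... | wf-⊓ _ wfD = Der-invert (x , C ⊓ D) ((x , D) ∷ []) (wfD ∷ []) (x , here refl)
      (λ _ → ⊤) _ (λ { _ (here refl) → inj₁ refl }) ((λ ()) , (λ ())) ((λ ()) , (λ ()))
      (λ ()) on⊓ (λ ()) (λ ()) tt d π
      where
      on⊓ : ∀ {h Γ Δ₀ Δ x' C' D'} → (x' , C' ⊓ D') ≡ (x , C ⊓ D) → ⊤ → Δ₀ ↭ Δ →
        Der O h (Γ ⊢ ((x' , C') ∷ Δ₀)) → Der O h (Γ ⊢ ((x' , D') ∷ Δ₀)) → Der O (suc h) (Γ ⊢ ((x , D) ∷ Δ))
      on⊓ refl _ q _ d₂ = Der-lift (Der-resp-↭ d₂ (prep _ q))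

    -- For an existing r-successor y of x, the eigenlabel of the ∀-premise is renamed to y
    -- (a sibling substitution), after which the duplicated atom r(x,y) is absorbed.
    Der-∀-inv : ∀ {h Γ Δc Δ x y r C} → rel r x y ∈ Γ → Der O h (Γ ⊢ Δc) → Δc ↭ (x , all r C) ∷ Δ →
      Der O h (Γ ⊢ ((y , C) ∷ GCI O y ++ Δ))
    Der-∀-inv {x = x} {y} {r} {C} rxy d π with Der⇒WFC-principal d π
    ... | wf-all wfC = Der-invert (x , all r C) ((y , C) ∷ GCI O y) (wfC ∷ WF-GCI y) (y , here refl)
      (rel r x y ∈_) (λ Γ⊆Γ' → Γ⊆Γ') T⊆ ((λ ()) , (λ ())) ((λ ()) , (λ ())) (λ ()) (λ ()) on∀ (λ ()) rxy d π
      where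
      T⊆ : ∀ {Γ v} → rel r x y ∈ Γ → v ∈LabC ((y , C) ∷ GCI O y) → v ≡ x ⊎ v ∈LabA Γ
      T⊆ rxy (here refl) = inj₂ (lose rxy occ-rel₂)
      T⊆ rxy (there l) rewrite ∈LabC-GCI⁻ {O} l = inj₂ (lose rxy occ-rel₂)
      on∀ : ∀ {h Γ Δc Δ₀ Δ x' y' r' C'} → (x' , all r' C') ≡ (x , all r C) → rel r x y ∈ Γ → Δ₀ ↭ Δ →
        Δc ↭ (x' , all r' C') ∷ Δ₀ → Fresh y' (Γ ⊢ Δc) →
        Der O h (AllPremise O r' x' y' C' Γ Δ₀) → Der O (suc h) (Γ ⊢ ((y , C) ∷ GCI O y ++ Δ))
      on∀ {h} {y' = e} refl rxy q p e-fresh d = Der-lift (Der-resp-↭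
        (Der-exchange (λ ()) (λ { (here refl) → rxy ; (there i) → i }) there
          (subst (Der O h) (AllPremise-rename y p e-fresh)
            (Der-subst h y e (inj₁ (here occ-rel₂)) (inj₂ (r , x , there rxy , here refl)) d)))
        (PP.++⁺ˡ ((y , C) ∷ GCI O y) q))

    Der-≤-inv : ∀ {h Γ Δc Δ x n r C} ys → length ys ≡ suc n →
      All (λ y → rel r x y ∈ Γ) ys → (∀ {a} → a ∈ neqs ys → a ∈ Γ) →
      Der O h (Γ ⊢ Δc) → Δc ↭ (x , atmost n r C) ∷ Δ → Der O h (Γ ⊢ (atmostSide O C ys ++ Δ))
    Der-≤-inv {x = x} {n} {r} {C} ys@(y ∷ _) l rys neqs⊆ d π with Der⇒WFC-principal d π
    ... | wf-atmost _ wfC = Der-invert (x , atmost n r C) (atmostSide O C ys) (WF-atmostSide ys wfC) (y , here refl)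
      Keep (λ Γ⊆Γ' k → All.map Γ⊆Γ' (proj₁ k) , Γ⊆Γ' ∘ proj₂ k) T⊆
      ((λ ()) , (λ ())) ((λ ()) , (λ ())) (λ ()) (λ ()) (λ ()) on≤ (rys , neqs⊆) d π
      where
      Keep : List SAtom → Set
      Keep Γ = All (λ y → rel r x y ∈ Γ) ys × (∀ {a} → a ∈ neqs ys → a ∈ Γ)
      T⊆ : ∀ {Γ v} → Keep Γ → v ∈LabC atmostSide O C ys → v ≡ x ⊎ v ∈LabA Γ
      T⊆ k l = inj₂ (lose (All.lookup (proj₁ k) (∈LabC-atmostSide⁻ {O} {C} ys l)) occ-rel₂)
      on≤ : ∀ {h Γ Δc Δ₀ Δ x' n' r' C'} → (x' , atmost n' r' C') ≡ (x , atmost n r C) → Keep Γ → Δ₀ ↭ Δ →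
        Δc ↭ (x' , atmost n' r' C') ∷ Δ₀ → ∀ zs → length zs ≡ suc n' → Unique zs →
        All (λ z → Fresh z (Γ ⊢ Δc)) zs →
        Der O h (AtmostPremise O r' x' C' zs Γ Δ₀) → Der O (suc h) (Γ ⊢ (atmostSide O C ys ++ Δ))
      on≤ {h} {Γ} refl (rys , neqs⊆) q p zs l' u f d = Der-lift (Der-resp-↭
        (Der-exchange (∈LabA⇒≢[] (source∈atmostAnte {Γ = Γ} ys l)) absorb (Γ⊆atmostAnte ys)
          (Der-≤-merge p [] zs ys (trans l' (sym l)) u f (All.universal (λ _ ()) zs) rys d))
        (PP.++⁺ˡ (atmostSide O C ys) q))
        where
        absorb : ∀ {a} → a ∈ neqs ys ++ map (rel r x) ys ++ Γ → a ∈ Γ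
        absorb i with ∈-++⁻ (neqs ys) i
        ... | inj₁ j = neqs⊆ j
        ... | inj₂ j with ∈-++⁻ (map (rel r x) ys) j
        ...   | inj₂ k = k
        ...   | inj₁ k with ∈-map⁻ (rel r x) k
        ...     | _ , y∈ys , refl = All.lookup rys y∈ys

    IsSeq-contract : ∀ {Γ Δc a Δ} → IsSeq O (Γ ⊢ Δc) → Δc ↭ a ∷ a ∷ Δ → IsSeq O (Γ ⊢ (a ∷ Δ))
    IsSeq-contract {a = a} s π =
      IsSeq-withSucc s (drop (PP.All-resp-↭ π (IsSeq⇒WFSucc s))) labels (λ _ → proj₁ a , here refl)
      where
      drop : ∀ {P : LConcept → Set} {Δ} → All P (a ∷ a ∷ Δ) → All P (a ∷ Δ)
      drop (pa ∷ _ ∷ pΔ) = pa ∷ pΔ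
      labels : ∀ v → v ∈LabC (a ∷ _) → v ∈Lab (_ ⊢ _)
      labels v (here e) = inj₂ (∈LabC-resp-↭ (↭-sym π) (here e))
      labels v (there l) = inj₂ (∈LabC-resp-↭ (↭-sym π) (there (there l)))

    Fresh-contract : ∀ {Γ Δc a Δ y} → Δc ↭ a ∷ a ∷ Δ → Fresh y (Γ ⊢ Δc) → Fresh y (Γ ⊢ (a ∷ Δ))
    Fresh-contract π f (inj₁ l) = f (inj₁ l)
    Fresh-contract π f (inj₂ (here e)) = f (inj₂ (∈LabC-resp-↭ (↭-sym π) (here e)))
    Fresh-contract π f (inj₂ (there l)) = f (inj₂ (∈LabC-resp-↭ (↭-sym π) (there (there l))))

    Der-contract-++ : ∀ {h} → (∀ {Γ Δc a Δ} → Der O h (Γ ⊢ Δc) → Δc ↭ a ∷ a ∷ Δ → Der O h (Γ ⊢ (a ∷ Δ))) →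
      ∀ A {Γ Δ} → Der O h (Γ ⊢ (A ++ A ++ Δ)) → Der O h (Γ ⊢ (A ++ Δ))
    Der-contract-++ contract [] d = d
    Der-contract-++ contract (a ∷ A) {Δ = Δ} d = Der-resp-↭
      (Der-contract-++ contract A (Der-resp-↭ (contract d (prep a (PP.shift a A (A ++ Δ))))
        (↭-trans (↭-++-push A (A ++ Δ)) (PP.++⁺ˡ A (↭-++-push A Δ)))))
      (PP.shift a A Δ)

    -- Where the contracted formula is principal, the premises are first inverted (⊔, ⊓, ∀, ≤),
    -- so that the induction hypothesis applies to the duplicated side formulas.
    Der-contract : ∀ h {Γ Δc a Δ} → Der O h (Γ ⊢ Δc) → Δc ↭ a ∷ a ∷ Δ → Der O h (Γ ⊢ (a ∷ Δ))

    private
      side : ∀ h {Γ a Δ R} A → Der O h (Γ ⊢ (A ++ Δ)) → Δ ↭ a ∷ a ∷ R → Der O h (Γ ⊢ (A ++ a ∷ R))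
      side h A d q = Der-resp-↭ (Der-contract h d (↭-++-pull₂ A q)) (↭-++-push A _)

      ∈-contract : ∀ {q a : LConcept} {Δ} → q ∈ a ∷ a ∷ Δ → q ∈ a ∷ Δ
      ∈-contract (here e) = here e
      ∈-contract (there (here e)) = here e
      ∈-contract (there (there i)) = there i

    Der-contract zero () π
    Der-contract (suc h) (r-id s p) π
      with ∈⇒↭∷∷ (∈-contract (PP.∈-resp-↭ (↭-trans (↭-sym p) π) (here refl)))
                 (∈-contract (PP.∈-resp-↭ (↭-trans (↭-sym p) π) (there (here refl)))) (λ ())
    ... | _ , q = r-id (IsSeq-contract s π) q
    Der-contract (suc h) (r-id≐ s n e) π = r-id≐ (IsSeq-contract s π) n e
    Der-contract (suc h) (r-s≐ {x = x} {y} {C} s p l e d) π with ∷∷↭∷-inv (↭-trans (↭-sym π) p)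
    ... | inj₁ (refl , q) = r-s≐ (IsSeq-contract s π) ↭-refl l e (Der-contract h d (prep _ (↭-prep-swap q)))
    ... | inj₂ (_ , q , q') = r-s≐ (IsSeq-contract s π) (↭-prep-swap q') l e
      (side h ((x , C) ∷ (y , C) ∷ []) d q)
    Der-contract (suc h) (r-∃ {x = x} {y} {r} {C} s p pr d) π with ∷∷↭∷-inv (↭-trans (↭-sym π) p)
    ... | inj₁ (refl , q) = r-∃ (IsSeq-contract s π) ↭-refl pr (Der-contract h d (prep _ (↭-prep-swap q)))
    ... | inj₂ (_ , q , q') = r-∃ (IsSeq-contract s π) (↭-prep-swap q') pr
      (side h ((x , ex r C) ∷ (y , C) ∷ []) d q)
    Der-contract (suc h) (r-≥ {x = x} {n} {r} {C} ys s p pr d₁ d₂) π with ∷∷↭∷-inv (↭-trans (↭-sym π) p)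
    ... | inj₁ (refl , q) = r-≥ ys (IsSeq-contract s π) ↭-refl pr
      (λ i → Der-resp-↭
        (Der-contract h (d₁ i) (↭-trans (prep _ (prep _ q)) (↭-trans (swap _ _ ↭-refl) (prep _ (swap _ _ ↭-refl)))))
               (swap _ _ ↭-refl))
      (λ i j i<j → Der-contract h (d₂ i j i<j) (prep _ q))
    ... | inj₂ (_ , q , q') = r-≥ ys (IsSeq-contract s π) (↭-prep-swap q') pr
      (λ i → side h ((lookup ys i , C) ∷ (x , atleast n r C) ∷ []) (d₁ i) q)
      (λ i j i<j → side h ((x , atleast n r C) ∷ []) (d₂ i j i<j) q)
    Der-contract (suc h) (r-⊔ {x = x} {C} {D} s p d) π with ∷∷↭∷-inv (↭-trans (↭-sym π) p)
    ... | inj₁ (refl , q) = r-⊔ (IsSeq-contract s π) ↭-refl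
      (Der-resp-↭ (Der-contract h (Der-contract h inverted (prep _ (swap _ _ ↭-refl)))
        (↭-trans (swap _ _ ↭-refl) (prep _ (swap _ _ ↭-refl)))) (swap _ _ ↭-refl))
      where
      inverted = Der-⊔-inv d (↭-trans (prep _ (prep _ q)) (↭-++-pull ((x , C) ∷ (x , D) ∷ []) ↭-refl))
    ... | inj₂ (_ , q , q') = r-⊔ (IsSeq-contract s π) (↭-prep-swap q')
      (side h ((x , C) ∷ (x , D) ∷ []) d q)
    Der-contract (suc h) (r-⊓ {x = x} {C} {D} s p d₁ d₂) π with ∷∷↭∷-inv (↭-trans (↭-sym π) p)
    ... | inj₁ (refl , q) = r-⊓ (IsSeq-contract s π) ↭-refl
      (Der-contract h (Der-⊓-invˡ d₁ (↭-prep-swap q)) ↭-refl)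
      (Der-contract h (Der-⊓-invʳ d₂ (↭-prep-swap q)) ↭-refl)
    ... | inj₂ (_ , q , q') = r-⊓ (IsSeq-contract s π) (↭-prep-swap q')
      (side h ((x , C) ∷ []) d₁ q) (side h ((x , D) ∷ []) d₂ q)
    Der-contract (suc h) (r-∀ {y = y} {C = C} s p f d) π with ∷∷↭∷-inv (↭-trans (↭-sym π) p)
    ... | inj₁ (refl , q) = r-∀ (IsSeq-contract s π) ↭-refl (Fresh-contract π f)
      (Der-contract-++ (Der-contract h) ((y , C) ∷ GCI O y)
        (Der-∀-inv (here refl) d (↭-++-pull ((y , C) ∷ GCI O y) q)))
    ... | inj₂ (_ , q , q') = r-∀ (IsSeq-contract s π) (↭-prep-swap q') (Fresh-contract π f)
      (side h ((y , C) ∷ GCI O y) d q)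
    Der-contract (suc h) (r-≤ {x = x} {r = r} {C} ys s p l u f d) π with ∷∷↭∷-inv (↭-trans (↭-sym π) p)
    ... | inj₁ (refl , q) = r-≤ ys (IsSeq-contract s π) ↭-refl l u (All.map (Fresh-contract π) f)
      (Der-contract-++ (Der-contract h) (atmostSide O C ys)
        (Der-≤-inv ys l (All.tabulate (rel∈atmostAnte ys)) ∈-++⁺ˡ
          d (↭-++-pull (atmostSide O C ys) q)))
    ... | inj₂ (_ , q , q') = r-≤ ys (IsSeq-contract s π) (↭-prep-swap q') l u (All.map (Fresh-contract π) f)
      (side h (atmostSide O C ys) d q)

⊤-provable : ∀ O Γ Δ x → IsSeq O (Γ ⊢ (Δ ++ (x , ⊤c) ∷ [])) → Provable O (Γ ⊢ (Δ ++ (x , ⊤c) ∷ []))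
⊤-provable O Γ Δ x s = 2 , r-⊔ s (↭-sym (PP.∷↭∷ʳ _ Δ)) (r-id {h = 0} s′ ↭-refl)
  where
  x∈ : x ∈Lab (Γ ⊢ (Δ ++ (x , ⊤c) ∷ []))
  x∈ = inj₂ (∈LabC-resp-↭ (PP.∷↭∷ʳ _ Δ) (here refl))
  s′ : IsSeq O (Γ ⊢ ((x , at A₀) ∷ (x , nat A₀) ∷ Δ))
  s′ = IsSeq-withSucc O s (wf-at ∷ wf-nat ∷ AllP.++⁻ˡ Δ (IsSeq⇒WFSucc O s))
    (λ { _ (here refl) → x∈ ; _ (there (here refl)) → x∈ ; _ (there (there l)) → inj₂ (∈LabC-++⁺ˡ l) })
    (λ _ → x , here refl)

subst-admissible : ∀ O Γ Δ x y h → Fresh x (Γ ⊢ Δ) → Der O h (Γ ⊢ Δ) → Der O h ([ x / y ]s (Γ ⊢ Δ))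
subst-admissible O Γ Δ x y h x-fresh d rewrite [/]s≡mapSeq x y (Γ ⊢ Δ) with y ∈Lab? (Γ ⊢ Δ)
... | yes y∈ = Der-subst O h x y y∈ (inj₁ x-fresh) d
... | no y∉ = subst (Der O h) (sym (cong₂ _⊢_ (mapAnte-id _ (fixed ∘ inj₁)) (mapSucc-id _ (fixed ∘ inj₂)))) d
  where
  fixed : ∀ {u} → u ∈Lab (Γ ⊢ Δ) → [ x / y ]ℓ u ≡ u
  fixed u∈ = [/]ℓ-miss λ { refl → y∉ u∈ }

w≐-admissible : ∀ O Γ Δ x y h → x ∈Lab (Γ ⊢ Δ) → y ∈Lab (Γ ⊢ Δ) →
  Der O h (Γ ⊢ Δ) → Der O h ((eq x y ∷ Γ) ⊢ Δ)
w≐-admissible O Γ Δ x y h x∈ y∈ d =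
  Der-embed O (Embeds-∷ O (eq x y) (Der⇒IsSeq O d) (λ ()) occ-eq₁ λ { occ-eq₁ → x∈ ; occ-eq₂ → y∈ }) d

w≠-admissible : ∀ O Γ Δ x y h → x ∈Lab (Γ ⊢ Δ) → y ∈Lab (Γ ⊢ Δ) →
  Der O h (Γ ⊢ Δ) → Der O h ((neq x y ∷ Γ) ⊢ Δ)
w≠-admissible O Γ Δ x y h x∈ y∈ d =
  Der-embed O (Embeds-∷ O (neq x y) (Der⇒IsSeq O d) (λ ()) occ-neq₁ λ { occ-neq₁ → x∈ ; occ-neq₂ → y∈ }) d

w-admissible : ∀ O Γ Δ x C h → x ∈Lab (Γ ⊢ Δ) → WFC (rbox O) C →
  Der O h (Γ ⊢ Δ) → Der O h (Γ ⊢ (Δ ++ (x , C) ∷ []))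
w-admissible O Γ Δ x C h x∈ wf d = Der-resp-↭ O (Der-weaken O x∈ wf d) (PP.∷↭∷ʳ _ Δ)

c-admissible : ∀ O → All (WFC (rbox O)) (tbox O) → ∀ Γ Δ x C h →
  Der O h (Γ ⊢ (Δ ++ (x , C) ∷ (x , C) ∷ [])) → Der O h (Γ ⊢ (Δ ++ (x , C) ∷ []))
c-admissible O wfTBox Γ Δ x C h d =
  Der-resp-↭ O (Der-contract O wfTBox h d (↭-trans (PP.shift _ Δ ((x , C) ∷ [])) (prep _ (↭-sym (PP.∷↭∷ʳ _ Δ)))))
    (PP.∷↭∷ʳ _ Δ)

s≠-admissible : ∀ O Γ Δ x y h → Der O h ((neq x y ∷ neq y x ∷ Γ) ⊢ Δ) → Der O h ((neq x y ∷ Γ) ⊢ Δ)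
s≠-admissible O Γ Δ x y h d = Der-embed O (Embeds-neq-sym O (Der⇒IsSeq O d)) d

lemma3 : (O : Ontology) → RIQ O →
    ((Γ : _) (Δ : _) (x : Label) →
       IsSeq O (Γ ⊢ (Δ ++ (x , ⊤c) ∷ [])) → Provable O (Γ ⊢ (Δ ++ (x , ⊤c) ∷ [])))
    × ((Γ : _) (Δ : _) (x y : Label) (h : ℕ) → Fresh x (Γ ⊢ Δ) →
       Der O h (Γ ⊢ Δ) → Der O h ([ x / y ]s (Γ ⊢ Δ)))
    × ((Γ : _) (Δ : _) (x y : Label) (h : ℕ) → x ∈Lab (Γ ⊢ Δ) → y ∈Lab (Γ ⊢ Δ) →
       Der O h (Γ ⊢ Δ) → Der O h ((eq x y ∷ Γ) ⊢ Δ))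
    × ((Γ : _) (Δ : _) (x y : Label) (h : ℕ) → x ∈Lab (Γ ⊢ Δ) → y ∈Lab (Γ ⊢ Δ) →
       Der O h (Γ ⊢ Δ) → Der O h ((neq x y ∷ Γ) ⊢ Δ))
    × ((Γ : _) (Δ : _) (x : Label) (C : Concept) (h : ℕ) → x ∈Lab (Γ ⊢ Δ) →
       WFC (rbox O) C →
       Der O h (Γ ⊢ Δ) → Der O h (Γ ⊢ (Δ ++ (x , C) ∷ [])))
    × ((Γ : _) (Δ : _) (x : Label) (C : Concept) (h : ℕ) →
       Der O h (Γ ⊢ (Δ ++ (x , C) ∷ (x , C) ∷ [])) → Der O h (Γ ⊢ (Δ ++ (x , C) ∷ [])))
    × ((Γ : _) (Δ : _) (x y : Label) (h : ℕ) →
       Der O h ((neq x y ∷ neq y x ∷ Γ) ⊢ Δ) → Der O h ((neq x y ∷ Γ) ⊢ Δ))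
lemma3 O (_ , wfTBox , _) =
  ⊤-provable O , subst-admissible O , w≐-admissible O , w≠-admissible O , w-admissible O ,
  c-admissible O wfTBox , s≠-admissible O
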